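{- For every integer $r\geq 3$ and every integer $n>6^r$, there exists a collection of $n$ matchings, each of size $n+\frac{1}{12r}n^{\frac{r-1}{r}}-1$, in an $r$-partite $r$-uniform hypergraph that does not admit a rainbow matching of size $n$.
   Context: A hypergraph is $r$-uniform if every edge has exactly $r$ vertices; an $r$-uniform hypergraph is $r$-partite if its vertex set can be partitioned into $r$ sets $V_1,\dots,V_r$ such that every edge contains exactly one vertex from each $V_i$. A matching is a set of pairwise vertex-disjoint edges. Given a collection of matchings $M_1,\dots,M_n$ in a hypergraph (not necessarily disjoint from each other), a matching $M\subseteq \bigcup_{i=1}^n M_i$ is rainbow if there is an injection $\phi: M\to[n]$ such that every edge $e\in M$ belongs to $M_{\phi(e)}$. -}

module Defs where

open import Data.Nat using (ℕ)
open import Data.Fin using (Fin)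
open import Data.List using (List)
open import Data.List.Membership.Propositional using (_∈_)
open import Data.List.Relation.Unary.AllPairs using (AllPairs)
open import Data.Product using (Σ; _×_)
open import Relation.Binary.PropositionalEquality using (_≡_; _≢_)
open import Function.Definitions using (Injective)

-- An edge of an r-partite r-uniform hypergraph with parts V_1,…,V_r,
-- where vertex j of part i is the pair (i , j) with j : ℕ.
-- The edge e is the vertex set { (i , e i) | i : Fin r }: exactly one
-- vertex from each part.
Edge : ℕ → Set
Edge r = Fin r → ℕ

Disjoint : ∀ {r} → Edge r → Edge r → Set
Disjoint e f = ∀ i → e i ≢ f i

IsMatching : ∀ {r} → List (Edge r) → Set
IsMatching M = AllPairs Disjoint M

RainbowMatching : ∀ {r} (n : ℕ) → (Fin n → List (Edge r)) → ℕ → Set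
RainbowMatching {r} n Ms k =
  Σ (Fin k → Edge r) λ g →
  Σ (Fin k → Fin n) λ φ →
    Injective _≡_ _≡_ φ ×
    (∀ a b → a ≢ b → Disjoint (g a) (g b)) ×
    (∀ a → g a ∈ Ms (φ a))

-- Positions 0, …, m − 1 carry a diagonal edge, with vertex k in every part, and a twisted edge
-- (F₀ k, …, F_{r−1} k), for injective maps F_i with F₀ = id. Take n = c + t matchings, c copies of the
-- diagonal matching and t of the twisted one, with m + 1 = n + S. The edges of a rainbow matching of
-- size n occupy n distinct positions (they are disjoint in part 0); let T be the set of positions of its
-- t twisted edges. A point F_i y ∉ T with y ∈ T is then unused, since a diagonal edge there would meet
-- the twisted edge at y in part i. So it suffices that every t-set T has S such outer boundary points.
--
-- The F_i are built from the shifts of a discrete torus with sides at most K (further positions stay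
-- fixed), and its edge-isoperimetric inequality min(|T|, N − |T|) ≤ K · Σ_l exits_l(T) shows that some
-- F_i moves at least S points out of T. The torus has r directions but there are only r − 1 non-identity
-- maps: two flows, graded by a coordinate sum mod 3, stand in for three directions, because
-- flow₀ ∘ flow₂ = flow₁ ∘ flow₁ bounds the exits of flow₀ by those of flow₁ and flow₂.
-- The sizes come from k = ⌊n^{1/r}⌋ and S = ⌊n / 12rk⌋ + 1; for r = 3 and n < 17³ this choice has too
-- little room, and a cyclic construction (n ≤ 610) or a table of checked parameters is used instead.

module Submission where

open import Defs
open import Data.Bool using (Bool; true; false; not; _∧_; T; if_then_else_)
open import Data.Bool.Properties using (not-injective; ∧-comm)
import Data.Bool.Properties as Bool
open import Data.Empty using (⊥)
open import Data.Fin using (Fin; zero; suc; toℕ; _↑ˡ_; _↑ʳ_; splitAt; join; combine; remQuot; inject≤; inject₁; lower₁)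
open import Data.Fin.Induction using (<-weakInduction)
open import Data.Fin.Properties
  using (toℕ-injective; toℕ-lower₁; toℕ-inject₁; toℕ<n; injective⇒≤; inject≤-injective; remQuot-combine; combine-remQuot;
         combine-injective; any?; ↑ˡ-injective; splitAt-↑ˡ; splitAt-↑ʳ; join-splitAt; splitAt-join)
import Data.Fin.Properties as Fin
open import Data.List using (List; tabulate; length)
open import Data.List.Properties using (length-tabulate)
open import Data.List.Membership.Propositional.Properties using (∈-tabulate⁻)
open import Data.List.Relation.Unary.AllPairs.Properties using () renaming (tabulate⁺ to allPairs-tabulate⁺)
open import Data.Nat
  using (ℕ; zero; suc; _+_; _*_; _∸_; _^_; _/_; _%_; _⊓_; _⊔_; pred; _≤_; _<_; _≤ᵇ_; _≡ᵇ_; _≤?_; _<?_; z≤n; s≤s; s≤s⁻¹;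
         NonZero; >-nonZero)
open import Data.Nat.DivMod using (m≡m%n+[m/n]*n; m%n<n; m/n*n≤m; /-monoˡ-≤)
open import Data.Nat.Divisibility using (_∣_; _∣?_; divides; m∣m*n; ∣m∣n⇒∣m+n)
open import Data.Nat.Properties
open import Data.Nat.Solver using (module +-*-Solver)
open +-*-Solver using (solve; _:=_; _:+_; _:*_; con)
open import Algebra.Properties.CommutativeSemigroup *-commutativeSemigroup
  using () renaming (x∙yz≈y∙xz to *-lcomm; interchange to *-interchange)
open import Algebra.Properties.CommutativeMonoid.Sum +-0-commutativeMonoid using (sum; sum-syntax; sum-cong-≗; ∑-distrib-+; ∑-comm)
open import Data.Product using (Σ; ∃; _×_; _,_; proj₁; proj₂; uncurry)
import Data.Product as Product
open import Data.Sum using (_⊎_; inj₁; inj₂; [_,_]′)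
import Data.Sum as Sum
import Data.Sum.Properties as Sum
open import Data.Unit using (tt)
open import Data.Vec using (Vec; []; _∷_; _∷ʳ_; lookup)
open import Data.Vec.Relation.Unary.All using (All; []; _∷_)
open import Function using (_∘_; id; const)
open import Function.Definitions using (Injective)
open import Relation.Binary.PropositionalEquality
open import Relation.Nullary using (¬_; Dec; yes; no; does; contradiction)
open import Relation.Nullary.Decidable using (_×-dec_; toWitness)
open import Relation.Unary using (Pred; Decidable)

private variable
  k n : ℕ

-- Finite sums and counting

∑-mono-≤ : {f g : Fin n → ℕ} → (∀ i → f i ≤ g i) → sum f ≤ sum g
∑-mono-≤ {zero}  f≤g = z≤n
∑-mono-≤ {suc n} f≤g = +-mono-≤ (f≤g zero) (∑-mono-≤ (f≤g ∘ suc))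

∑-const : ∀ n x → ∑[ i < n ] x ≡ n * x
∑-const zero    x = refl
∑-const (suc n) x = cong (x +_) (∑-const n x)

*-distribˡ-∑ : ∀ a (f : Fin n → ℕ) → a * sum f ≡ ∑[ i < n ] (a * f i)
*-distribˡ-∑ {zero}  a f = *-zeroʳ a
*-distribˡ-∑ {suc n} a f = trans (*-distribˡ-+ a (f zero) _) (cong (a * f zero +_) (*-distribˡ-∑ a (f ∘ suc)))

∑-split : ∀ m n (f : Fin (m + n) → ℕ) → sum f ≡ ∑[ i < m ] f (i ↑ˡ n) + ∑[ j < n ] f (m ↑ʳ j)
∑-split zero    n f = refl
∑-split (suc m) n f = trans (cong (f zero +_) (∑-split m n (f ∘ suc))) (sym (+-assoc (f zero) _ _))

∑-combine : ∀ m n (f : Fin (m * n) → ℕ) → sum f ≡ ∑[ i < m ] ∑[ j < n ] f (combine i j)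
∑-combine zero    n f = refl
∑-combine (suc m) n f = trans (∑-split n (m * n) f) (cong (∑[ j < n ] f (j ↑ˡ (m * n)) +_) (∑-combine m n (f ∘ (n ↑ʳ_))))

∑-∸ : {f g : Fin n → ℕ} → (∀ i → f i ≤ g i) → ∑[ i < n ] (g i ∸ f i) ≡ sum g ∸ sum f
∑-∸ {n} {f} {g} f≤g = sym (begin
  sum g ∸ sum f                                ≡⟨ cong (_∸ sum f) (sum-cong-≗ (λ i → m∸n+n≡m (f≤g i))) ⟨
  ∑[ i < n ] (g i ∸ f i + f i) ∸ sum f          ≡⟨ cong (_∸ sum f) (∑-distrib-+ (λ i → g i ∸ f i) f) ⟩
  ∑[ i < n ] (g i ∸ f i) + sum f ∸ sum f        ≡⟨ m+n∸n≡m _ (sum f) ⟩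
  ∑[ i < n ] (g i ∸ f i)                        ∎)
  where open ≡-Reasoning

indicator : Bool → ℕ
indicator true  = 1
indicator false = 0

count : (Fin n → Bool) → ℕ
count {n} P = ∑[ i < n ] indicator (P i)

count-cong : {P Q : Fin n → Bool} → (∀ i → P i ≡ Q i) → count P ≡ count Q
count-cong P≗Q = sum-cong-≗ (cong indicator ∘ P≗Q)

count-true : (P : Fin n → Bool) → (∀ i → P i ≡ true) → count P ≡ n
count-true {n} P all = trans (count-cong all) (trans (∑-const n 1) (*-identityʳ n))

count-false : (P : Fin n → Bool) → (∀ i → P i ≡ false) → count P ≡ 0
count-false {n} P none = trans (count-cong none) (trans (∑-const n 0) (*-zeroʳ n))

count-≤ : (P : Fin n → Bool) → count P ≤ n
count-≤ {n} P = subst (count P ≤_) (trans (∑-const n 1) (*-identityʳ n)) (∑-mono-≤ (indicator≤1 ∘ P))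
  where
  indicator≤1 : ∀ b → indicator b ≤ 1
  indicator≤1 true  = s≤s z≤n
  indicator≤1 false = z≤n

count-complement : (P : Fin n → Bool) → count P + count (not ∘ P) ≡ n
count-complement P = trans (sym (∑-distrib-+ (indicator ∘ P) (indicator ∘ not ∘ P)))
  (trans (sum-cong-≗ (complement ∘ P)) (count-true (λ _ → true) (λ _ → refl)))
  where
  complement : ∀ b → indicator b + indicator (not b) ≡ 1
  complement true  = refl
  complement false = refl

count-split : (P Q : Fin n → Bool) → count P ≡ count (λ i → P i ∧ Q i) + count (λ i → P i ∧ not (Q i))
count-split P Q = trans (sum-cong-≗ (λ i → split (P i) (Q i)))
  (∑-distrib-+ (λ i → indicator (P i ∧ Q i)) (λ i → indicator (P i ∧ not (Q i))))
  where
  split : ∀ p q → indicator p ≡ indicator (p ∧ q) + indicator (p ∧ not q)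
  split true  true  = refl
  split true  false = refl
  split false q     = refl

indicator≡0 : ∀ {b} → indicator b ≡ 0 → b ≡ false
indicator≡0 {false} _ = refl

count≡0⇒false : (P : Fin n → Bool) → count P ≡ 0 → ∀ i → P i ≡ false
count≡0⇒false P eq zero    = indicator≡0 (m+n≡0⇒m≡0 _ eq)
count≡0⇒false P eq (suc i) = count≡0⇒false (P ∘ suc) (m+n≡0⇒n≡0 _ eq) i

count≡n⇒true : (P : Fin n → Bool) → count P ≡ n → ∀ i → P i ≡ true
count≡n⇒true P eq i = not-injective (count≡0⇒false (not ∘ P) none i)
  where
  none : count (not ∘ P) ≡ 0
  none = +-cancelˡ-≡ (count P) _ 0 (trans (count-complement P) (trans (sym eq) (sym (+-identityʳ _))))

enumerate : (P : Fin n → Bool) → Fin (count P) → Fin n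
enumerate {suc n} P i with P zero
enumerate {suc n} P zero    | true  = zero
enumerate {suc n} P (suc i) | true  = suc (enumerate (P ∘ suc) i)
enumerate {suc n} P i       | false = suc (enumerate (P ∘ suc) i)

enumerate-sound : (P : Fin n → Bool) (i : Fin (count P)) → P (enumerate P i) ≡ true
enumerate-sound {suc n} P i with P zero in P0
enumerate-sound {suc n} P zero    | true  = P0
enumerate-sound {suc n} P (suc i) | true  = enumerate-sound (P ∘ suc) i
enumerate-sound {suc n} P i       | false = enumerate-sound (P ∘ suc) i

enumerate-injective : (P : Fin n → Bool) → Injective _≡_ _≡_ (enumerate P)
enumerate-injective {suc n} P {i} {j} eq with P zero
enumerate-injective {suc n} P {zero}  {zero}  eq | true  = refl
enumerate-injective {suc n} P {suc i} {suc j} eq | true  = cong suc (enumerate-injective (P ∘ suc) (Fin.suc-injective eq))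
enumerate-injective {suc n} P {i}     {j}     eq | false = enumerate-injective (P ∘ suc) (Fin.suc-injective eq)

enumerate-surjective : (P : Fin n → Bool) (x : Fin n) → P x ≡ true → ∃ λ i → enumerate P i ≡ x
enumerate-surjective {suc n} P x Px with P zero in P0
enumerate-surjective {suc n} P zero    Px | true  = zero , refl
enumerate-surjective {suc n} P (suc x) Px | true  = let i , eq = enumerate-surjective (P ∘ suc) x Px in suc i , cong suc eq
enumerate-surjective {suc n} P zero    Px | false = contradiction (trans (sym P0) Px) λ ()
enumerate-surjective {suc n} P (suc x) Px | false = let i , eq = enumerate-surjective (P ∘ suc) x Px in i , cong suc eq

injection⇒≤count : ∀ {m} (P : Fin n → Bool) {h : Fin m → Fin n} →
  Injective _≡_ _≡_ h → (∀ i → P (h i) ≡ true) → m ≤ count P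
injection⇒≤count {m = m} P {h} h-inj P∘h = injective⇒≤ rank-injective
  where
  rank : Fin m → Fin (count P)
  rank i = proj₁ (enumerate-surjective P (h i) (P∘h i))

  rank-injective : Injective _≡_ _≡_ rank
  rank-injective {i} {j} eq = h-inj (begin
    h i                ≡⟨ proj₂ (enumerate-surjective P (h i) (P∘h i)) ⟨
    enumerate P (rank i) ≡⟨ cong (enumerate P) eq ⟩
    enumerate P (rank j) ≡⟨ proj₂ (enumerate-surjective P (h j) (P∘h j)) ⟩
    h j                ∎)
    where open ≡-Reasoning

count-≤-injection : ∀ {m} (P : Fin m → Bool) (Q : Fin n → Bool) {g : Fin m → Fin n} → Injective _≡_ _≡_ g →
  (∀ x → P x ≡ true → Q (g x) ≡ true) → count P ≤ count Q
count-≤-injection P Q g-inj P⇒Q∘g =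
  injection⇒≤count Q (enumerate-injective P ∘ g-inj) (λ i → P⇒Q∘g _ (enumerate-sound P i))

count-∘-injective : (P : Fin n → Bool) {g : Fin n → Fin n} → Injective _≡_ _≡_ g → count (P ∘ g) ≡ count P
count-∘-injective {n} P {g} g-inj = ≤-antisym
  (count-≤-injection (P ∘ g) P g-inj (λ _ Pgx → Pgx))
  (+-cancelʳ-≤ (count (not ∘ P)) (count P) (count (P ∘ g)) (begin
    count P + count (not ∘ P)       ≡⟨ count-complement P ⟩
    n                               ≡⟨ count-complement (P ∘ g) ⟨
    count (P ∘ g) + count (not ∘ P ∘ g) ≤⟨ +-monoʳ-≤ (count (P ∘ g)) (count-≤-injection (not ∘ P ∘ g) (not ∘ P) g-inj (λ _ p → p)) ⟩
    count (P ∘ g) + count (not ∘ P) ∎))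
  where open ≤-Reasoning

count≡1⇒unique : (T : Fin n → Bool) → count T ≡ 1 → ∀ {x y} → T y ≡ true → x ≢ y → T x ≡ false
count≡1⇒unique T |T|≡1 {x} {y} Ty x≢y with T x in Tx
... | false = refl
... | true  = contradiction (≤-trans (injection⇒≤count T pair-injective pair-in) (≤-reflexive |T|≡1)) λ { (s≤s ()) }
  where
  pair : Fin 2 → Fin _
  pair zero       = x
  pair (suc zero) = y
  pair-injective : Injective _≡_ _≡_ pair
  pair-injective {zero}     {zero}     _  = refl
  pair-injective {zero}     {suc zero} eq = contradiction eq x≢y
  pair-injective {suc zero} {zero}     eq = contradiction (sym eq) x≢y
  pair-injective {suc zero} {suc zero} _  = refl
  pair-in : ∀ i → T (pair i) ≡ true
  pair-in zero       = Tx
  pair-in (suc zero) = Ty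

image : ∀ {m} (f : Fin m → Fin n) (P : Fin m → Bool) → Fin n → Bool
image f P y = does (any? (λ x → (P x Bool.≟ true) ×-dec (f x Fin.≟ y)))

image-intro : ∀ {m} (f : Fin m → Fin n) (P : Fin m → Bool) x → P x ≡ true → image f P (f x) ≡ true
image-intro f P x Px with any? (λ x′ → (P x′ Bool.≟ true) ×-dec (f x′ Fin.≟ f x))
... | yes _ = refl
... | no  ∄ = contradiction (x , Px , refl) ∄

image-witness : ∀ {m} (f : Fin m → Fin n) (P : Fin m → Bool) y → image f P y ≡ true → ∃ λ x → P x ≡ true × f x ≡ y
image-witness f P y eq with any? (λ x → (P x Bool.≟ true) ×-dec (f x Fin.≟ y))
image-witness f P y eq | yes w = w
image-witness f P y () | no  _

count-image : ∀ {m} {f : Fin m → Fin n} → Injective _≡_ _≡_ f → (P : Fin m → Bool) → count (image f P) ≡ count P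
count-image {f = f} f-inj P = ≤-antisym
  (injection⇒≤count P owner-injective (proj₁ ∘ proj₂ ∘ owner))
  (count-≤-injection P (image f P) f-inj (image-intro f P))
  where
  owner : ∀ i → ∃ λ x → P x ≡ true × f x ≡ enumerate (image f P) i
  owner i = image-witness f P _ (enumerate-sound (image f P) i)
  owner-injective : Injective _≡_ _≡_ (proj₁ ∘ owner)
  owner-injective {i} {j} eq = enumerate-injective (image f P)
    (trans (sym (proj₂ (proj₂ (owner i)))) (trans (cong f eq) (proj₂ (proj₂ (owner j)))))

exits : (Fin n → Fin n) → (Fin n → Bool) → ℕ
exits g T = count (λ x → T x ∧ not (T (g x)))

entries≡exits : (T : Fin n → Bool) {g : Fin n → Fin n} → Injective _≡_ _≡_ g →
  count (λ x → not (T x) ∧ T (g x)) ≡ exits g T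
entries≡exits T {g} g-inj = +-cancelˡ-≡ (count (λ x → T (g x) ∧ T x)) _ _ (begin
  count (λ x → T (g x) ∧ T x) + count (λ x → not (T x) ∧ T (g x))
    ≡⟨ cong (count (λ x → T (g x) ∧ T x) +_) (count-cong (λ x → ∧-comm (not (T x)) (T (g x)))) ⟩
  count (λ x → T (g x) ∧ T x) + count (λ x → T (g x) ∧ not (T x))
    ≡⟨ count-split (T ∘ g) T ⟨
  count (T ∘ g)
    ≡⟨ count-∘-injective T g-inj ⟩
  count T
    ≡⟨ count-split T (T ∘ g) ⟩
  count (λ x → T x ∧ T (g x)) + exits g T
    ≡⟨ cong (_+ exits g T) (count-cong (λ x → ∧-comm (T x) (T (g x)))) ⟩
  count (λ x → T (g x) ∧ T x) + exits g T ∎)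
  where open ≡-Reasoning

exits≡0⇒invariant : (T : Fin n → Bool) {g : Fin n → Fin n} → Injective _≡_ _≡_ g →
  exits g T ≡ 0 → ∀ x → T (g x) ≡ T x
exits≡0⇒invariant T {g} g-inj no-exits x = stable (T x) (T (g x))
  (count≡0⇒false _ no-exits x)
  (count≡0⇒false _ (trans (entries≡exits T g-inj) no-exits) x)
  where
  stable : ∀ p q → p ∧ not q ≡ false → not p ∧ q ≡ false → q ≡ p
  stable true  true  _ _ = refl
  stable false false _ _ = refl

exits-∘ : (T : Fin n → Bool) {f g h k : Fin n → Fin n} → Injective _≡_ _≡_ g → Injective _≡_ _≡_ k →
  (∀ x → h (k x) ≡ f (g x)) → exits h T ≤ exits k T + exits g T + exits f T
exits-∘ {n} T {f} {g} {h} {k} g-inj k-inj hk≗fg = begin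
  exits h T
    ≡⟨ count-∘-injective (λ x → T x ∧ not (T (h x))) k-inj ⟨
  count (λ y → T (k y) ∧ not (T (h (k y))))
    ≡⟨ count-cong (λ y → cong (λ z → T (k y) ∧ not (T z)) (hk≗fg y)) ⟩
  count (λ y → T (k y) ∧ not (T (f (g y))))
    ≤⟨ ∑-mono-≤ (λ y → via (T (k y)) (T y) (T (g y)) (T (f (g y)))) ⟩
  ∑[ y < n ] (enter y + leave y + leaveᶠ y)
    ≡⟨ ∑-distrib-+ (λ y → enter y + leave y) leaveᶠ ⟩
  ∑[ y < n ] (enter y + leave y) + sum leaveᶠ
    ≡⟨ cong (_+ sum leaveᶠ) (∑-distrib-+ enter leave) ⟩
  sum enter + exits g T + sum leaveᶠ
    ≡⟨ cong₂ (λ a b → a + exits g T + b) (entries≡exits T k-inj) (count-∘-injective (λ z → T z ∧ not (T (f z))) g-inj) ⟩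
  exits k T + exits g T + exits f T ∎
  where
  open ≤-Reasoning
  enter leave leaveᶠ : Fin n → ℕ
  enter  y = indicator (not (T y) ∧ T (k y))
  leave  y = indicator (T y ∧ not (T (g y)))
  leaveᶠ y = indicator (T (g y) ∧ not (T (f (g y))))
  via : ∀ p t u q → indicator (p ∧ not q) ≤ indicator (not t ∧ p) + indicator (t ∧ not u) + indicator (u ∧ not q)
  via false t     u     q     = z≤n
  via true  t     u     true  = z≤n
  via true  false u     false = s≤s z≤n
  via true  true  false false = s≤s z≤n
  via true  true  true  false = s≤s z≤n

record OuterBoundary {r : ℕ} (F : Fin r → Fin n → Fin n) (T : Fin n → Bool) (S : ℕ) : Set where
  field
    point           : Fin S → Fin n
    point-injective : Injective _≡_ _≡_ point
    point-outside   : ∀ s → T (point s) ≡ false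
    point-reached   : ∀ s → ∃ λ i → ∃ λ y → T y ≡ true × point s ≡ F i y

exits⇒outerBoundary : ∀ {r S} (F : Fin r → Fin n → Fin n) (T : Fin n → Bool) (i : Fin r) →
  Injective _≡_ _≡_ (F i) → S ≤ exits (F i) T → OuterBoundary F T S
exits⇒outerBoundary F T i Fi-inj S≤exits = record
  { point           = F i ∘ leaving
  ; point-injective = inject≤-injective _ _ _ _ ∘ enumerate-injective E ∘ Fi-inj
  ; point-outside   = λ s → not-injective (proj₂ (∧-true (leaving-sound s)))
  ; point-reached   = λ s → i , leaving s , proj₁ (∧-true (leaving-sound s)) , refl
  }
  where
  E : Fin _ → Bool
  E x = T x ∧ not (T (F i x))
  leaving : Fin _ → Fin _
  leaving s = enumerate E (inject≤ s S≤exits)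
  leaving-sound : ∀ s → E (leaving s) ≡ true
  leaving-sound s = enumerate-sound E (inject≤ s S≤exits)
  ∧-true : ∀ {p q} → p ∧ q ≡ true → p ≡ true × q ≡ true
  ∧-true {true} {true} _ = refl , refl

rotate : Fin n → Fin n
rotate {suc n} i with n ≟ toℕ i
... | yes _   = zero
... | no  n≢i = lower₁ (suc i) (n≢i ∘ suc-injective)

rotate-last : (i : Fin (suc n)) → toℕ i ≡ n → rotate i ≡ zero
rotate-last {n} i i≡n with n ≟ toℕ i
... | yes _   = refl
... | no  n≢i = contradiction (sym i≡n) n≢i

toℕ-rotate : (i : Fin (suc n)) → toℕ i ≢ n → toℕ (rotate i) ≡ suc (toℕ i)
toℕ-rotate {n} i i≢n with n ≟ toℕ i
... | yes n≡i = contradiction (sym n≡i) i≢n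
... | no  n≢i = toℕ-lower₁ (suc i) (n≢i ∘ suc-injective)

toℕ-rotate-cases : (i : Fin (suc n)) → toℕ (rotate i) ≡ suc (toℕ i) ⊎ (toℕ i ≡ n × toℕ (rotate i) ≡ 0)
toℕ-rotate-cases {n} i with toℕ i ≟ n
... | yes i≡n = inj₂ (i≡n , cong toℕ (rotate-last i i≡n))
... | no  i≢n = inj₁ (toℕ-rotate i i≢n)

rotate-injective : Injective _≡_ _≡_ (rotate {n})
rotate-injective {suc n} {i} {j} eq with toℕ i ≟ n | toℕ j ≟ n
... | yes i≡n | yes j≡n = toℕ-injective (trans i≡n (sym j≡n))
... | yes i≡n | no  j≢n = contradiction (trans (cong toℕ (trans (sym (rotate-last i i≡n)) eq)) (toℕ-rotate j j≢n)) 0≢1+n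
... | no  i≢n | yes j≡n = contradiction (trans (cong toℕ (trans (sym (rotate-last j j≡n)) (sym eq))) (toℕ-rotate i i≢n)) 0≢1+n
... | no  i≢n | no  j≢n = toℕ-injective (suc-injective (begin
  suc (toℕ i)  ≡⟨ toℕ-rotate i i≢n ⟨
  toℕ (rotate i) ≡⟨ cong toℕ eq ⟩
  toℕ (rotate j) ≡⟨ toℕ-rotate j j≢n ⟩
  suc (toℕ j)  ∎))
  where open ≡-Reasoning

rotate-inject₁ : (i : Fin n) → rotate (inject₁ i) ≡ suc i
rotate-inject₁ {n} i = toℕ-injective (trans (toℕ-rotate (inject₁ i) i≢n) (cong suc (toℕ-inject₁ i)))
  where
  i≢n : toℕ (inject₁ i) ≢ n
  i≢n eq = <-irrefl (trans (sym (toℕ-inject₁ i)) eq) (toℕ<n i)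

rotate-≢ : (x : Fin (suc (suc n))) → rotate x ≢ x
rotate-≢ x eq with toℕ-rotate-cases x
... | inj₁ rx≡1+x        = <-irrefl (trans (sym (cong toℕ eq)) rx≡1+x) (n<1+n (toℕ x))
... | inj₂ (x≡n , rx≡0) = 0≢1+n (trans (sym rx≡0) (trans (cong toℕ eq) x≡n))

rotate²-≢ : (x : Fin (suc (suc (suc n)))) → rotate (rotate x) ≢ x
rotate²-≢ x eq with toℕ-rotate-cases x | toℕ-rotate-cases (rotate x) | cong toℕ eq
... | inj₁ rx≡1+x       | inj₁ rrx≡1+rx       | rrx≡x =
  <-irrefl (trans (sym rrx≡x) (trans rrx≡1+rx (cong suc rx≡1+x))) (m<n⇒m<1+n (n<1+n (toℕ x)))
... | inj₁ rx≡1+x       | inj₂ (rx≡N , rrx≡0) | rrx≡x =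
  0≢1+n (suc-injective (trans (sym (trans rx≡1+x (cong suc (trans (sym rrx≡x) rrx≡0)))) rx≡N))
... | inj₂ (x≡N , rx≡0) | inj₁ rrx≡1+rx       | rrx≡x =
  0≢1+n (suc-injective (trans (sym (trans rrx≡1+rx (cong suc rx≡0))) (trans rrx≡x x≡N)))
... | inj₂ (x≡N , rx≡0) | inj₂ (rx≡N , rrx≡0) | rrx≡x = 0≢1+n (trans (sym rx≡0) rx≡N)

rotate-invariant⇒constant : (h : Fin (suc n) → Bool) → (∀ i → h (rotate i) ≡ h i) → ∀ j → h j ≡ h zero
rotate-invariant⇒constant h invariant = <-weakInduction (λ j → h j ≡ h zero) refl step
  where
  step : ∀ i → h (inject₁ i) ≡ h zero → h (suc i) ≡ h zero
  step i hi≡h0 = trans (cong h (sym (rotate-inject₁ i))) (trans (invariant (inject₁ i)) hi≡h0)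

exits-rotate-partial : (h : Fin k → Bool) → 0 < count h → count h < k → 0 < exits rotate h
exits-rotate-partial {suc k} h 0<|h| |h|<k = n≢0⇒n>0 λ no-exits →
  constant (h zero) refl (rotate-invariant⇒constant h (exits≡0⇒invariant h rotate-injective no-exits))
  where
  constant : ∀ b → h zero ≡ b → (∀ j → h j ≡ h zero) → ⊥
  constant true  h0 const = <⇒≢ |h|<k (count-true h (λ j → trans (const j) h0))
  constant false h0 const = >⇒≢ 0<|h| (count-false h (λ j → trans (const j) h0))

-- Columns of a subset of a grid

≡ᵇ-true⇒≡ : ∀ {m n} → (m ≡ᵇ n) ≡ true → m ≡ n
≡ᵇ-true⇒≡ {m} {n} eq = ≡ᵇ⇒≡ m n (subst T (sym eq) tt)

full empty partial : (Fin k → Bool) → ℕ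
full    {k} h = indicator (count h ≡ᵇ k)
empty       h = indicator (count h ≡ᵇ 0)
partial {k} h = indicator (not (count h ≡ᵇ k) ∧ not (count h ≡ᵇ 0))

count-≤-full+partial : (h : Fin k → Bool) → count h ≤ k * full h + k * partial h
count-≤-full+partial {k} h with count h ≡ᵇ k in isFull | count h ≡ᵇ 0 in isEmpty
... | true  | _     = ≤-trans (≤-reflexive (trans (≡ᵇ-true⇒≡ isFull) (sym (*-identityʳ k)))) (m≤m+n _ _)
... | false | true  = ≤-trans (≤-reflexive (≡ᵇ-true⇒≡ isEmpty)) z≤n
... | false | false = ≤-trans (count-≤ h) (≤-trans (≤-reflexive (sym (*-identityʳ k))) (m≤n+m _ _))

gap-≤-empty+partial : (h : Fin k → Bool) → k ∸ count h ≤ k * empty h + k * partial h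
gap-≤-empty+partial {k} h with count h ≡ᵇ k in isFull | count h ≡ᵇ 0 in isEmpty
... | true  | _     = ≤-trans (≤-reflexive (trans (cong (k ∸_) (≡ᵇ-true⇒≡ {count h} isFull)) (n∸n≡0 k))) z≤n
... | false | true  = ≤-trans (m∸n≤m k (count h)) (≤-trans (≤-reflexive (sym (*-identityʳ k))) (m≤m+n _ _))
... | false | false = ≤-trans (m∸n≤m k (count h)) (≤-trans (≤-reflexive (sym (*-identityʳ k))) (m≤n+m _ _))

full≤member : (h : Fin k → Bool) (i : Fin k) → full h ≤ indicator (h i)
full≤member {k} h i with count h ≡ᵇ k in isFull
... | false = z≤n
... | true  = ≤-reflexive (cong indicator (sym (count≡n⇒true h (≡ᵇ-true⇒≡ isFull) i)))

empty≤nonmember : (h : Fin k → Bool) (i : Fin k) → empty h ≤ indicator (not (h i))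
empty≤nonmember h i with count h ≡ᵇ 0 in isEmpty
... | false = z≤n
... | true  = ≤-reflexive (cong (indicator ∘ not) (sym (count≡0⇒false h (≡ᵇ-true⇒≡ isEmpty) i)))

partial≤exits : (h : Fin k → Bool) → partial h ≤ exits rotate h
partial≤exits {k} h with count h ≡ᵇ k in isFull | count h ≡ᵇ 0 in isEmpty
... | true  | _     = z≤n
... | false | true  = z≤n
... | false | false = exits-rotate-partial h
  (n≢0⇒n>0 (λ eq → contradiction (≡⇒≡ᵇ _ _ eq) (subst T isEmpty)))
  (≤∧≢⇒< (count-≤ h) (λ eq → contradiction (≡⇒≡ᵇ _ _ eq) (subst T isFull)))

module Grid (a c : ℕ) where

  infixr 7 _⊗_

  _⊗_ : (Fin a → Fin a) → (Fin c → Fin c) → Fin (a * c) → Fin (a * c)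
  (f ⊗ g) x = uncurry combine (Product.map f g (remQuot {a} c x))

  ⊗-combine : (f : Fin a → Fin a) (g : Fin c → Fin c) (i : Fin a) (j : Fin c) →
    (f ⊗ g) (combine i j) ≡ combine (f i) (g j)
  ⊗-combine f g i j = cong (uncurry combine ∘ Product.map f g) (remQuot-combine i j)

  remQuot-⊗ : (f : Fin a → Fin a) (g : Fin c → Fin c) (x : Fin (a * c)) →
    remQuot {a} c ((f ⊗ g) x) ≡ Product.map f g (remQuot {a} c x)
  remQuot-⊗ f g x = remQuot-combine (f (proj₁ (remQuot {a} c x))) (g (proj₂ (remQuot {a} c x)))

  ⊗-∘ : (f f′ : Fin a → Fin a) (g g′ : Fin c → Fin c) (x : Fin (a * c)) →
    (f ⊗ g) ((f′ ⊗ g′) x) ≡ ((f ∘ f′) ⊗ (g ∘ g′)) x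
  ⊗-∘ f f′ g g′ x = cong (uncurry combine ∘ Product.map f g) (remQuot-⊗ f′ g′ x)

  ⊗-congʳ : (f : Fin a → Fin a) {g g′ : Fin c → Fin c} → (∀ y → g y ≡ g′ y) → ∀ x → (f ⊗ g) x ≡ (f ⊗ g′) x
  ⊗-congʳ f g≗g′ x = cong (combine (f (proj₁ (remQuot {a} c x)))) (g≗g′ (proj₂ (remQuot {a} c x)))

  ⊗-injective : {f : Fin a → Fin a} {g : Fin c → Fin c} →
    Injective _≡_ _≡_ f → Injective _≡_ _≡_ g → Injective _≡_ _≡_ (f ⊗ g)
  ⊗-injective {f} {g} f-inj g-inj {x} {y} eq = begin
    x                                 ≡⟨ combine-remQuot {a} c x ⟨
    uncurry combine (remQuot {a} c x) ≡⟨ cong₂ combine (f-inj (proj₁ same)) (g-inj (proj₂ same)) ⟩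
    uncurry combine (remQuot {a} c y) ≡⟨ combine-remQuot {a} c y ⟩
    y                                 ∎
    where
    open ≡-Reasoning
    same = combine-injective (f (proj₁ (remQuot {a} c x))) (g (proj₂ (remQuot {a} c x)))
                             (f (proj₁ (remQuot {a} c y))) (g (proj₂ (remQuot {a} c y))) eq

  row : (Fin (a * c) → Bool) → Fin a → Fin c → Bool
  row T i j = T (combine i j)

  column : (Fin (a * c) → Bool) → Fin c → Fin a → Bool
  column T j i = T (combine i j)

  count-rows : (T : Fin (a * c) → Bool) → count T ≡ ∑[ i < a ] count (row T i)
  count-rows T = ∑-combine a c (indicator ∘ T)

  count-columns : (T : Fin (a * c) → Bool) → count T ≡ ∑[ j < c ] count (column T j)
  count-columns T = trans (count-rows T) (∑-comm (λ i j → indicator (row T i j)))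

  exits-⊗ˡ : (f : Fin a → Fin a) (T : Fin (a * c) → Bool) → exits (f ⊗ id) T ≡ ∑[ j < c ] exits f (column T j)
  exits-⊗ˡ f T = begin
    exits (f ⊗ id) T
      ≡⟨ ∑-combine a c _ ⟩
    ∑[ i < a ] ∑[ j < c ] indicator (row T i j ∧ not (T ((f ⊗ id) (combine i j))))
      ≡⟨ sum-cong-≗ (λ i → sum-cong-≗ (λ j → cong (λ y → indicator (row T i j ∧ not (T y))) (⊗-combine f id i j))) ⟩
    ∑[ i < a ] ∑[ j < c ] indicator (row T i j ∧ not (row T (f i) j))
      ≡⟨ ∑-comm (λ i j → indicator (row T i j ∧ not (row T (f i) j))) ⟩
    ∑[ j < c ] exits f (column T j) ∎
    where open ≡-Reasoning

  exits-⊗ʳ : (g : Fin c → Fin c) (T : Fin (a * c) → Bool) → exits (id ⊗ g) T ≡ ∑[ i < a ] exits g (row T i)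
  exits-⊗ʳ g T = trans (∑-combine a c _)
    (sum-cong-≗ (λ i → sum-cong-≗ (λ j → cong (λ y → indicator (row T i j ∧ not (T y))) (⊗-combine id g i j))))

  fullColumns emptyColumns partialColumns : (Fin (a * c) → Bool) → ℕ
  fullColumns    T = ∑[ j < c ] full (column T j)
  emptyColumns   T = ∑[ j < c ] empty (column T j)
  partialColumns T = ∑[ j < c ] partial (column T j)

  count≤full+partial : (T : Fin (a * c) → Bool) → count T ≤ a * fullColumns T + a * partialColumns T
  count≤full+partial T = begin
    count T                                                         ≡⟨ count-columns T ⟩
    ∑[ j < c ] count (column T j)                                   ≤⟨ ∑-mono-≤ (count-≤-full+partial ∘ column T) ⟩
    ∑[ j < c ] (a * full (column T j) + a * partial (column T j))   ≡⟨ ∑-distrib-+ (λ j → a * full (column T j)) _ ⟩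
    ∑[ j < c ] (a * full (column T j)) + ∑[ j < c ] (a * partial (column T j))
      ≡⟨ cong₂ _+_ (*-distribˡ-∑ a (full ∘ column T)) (*-distribˡ-∑ a (partial ∘ column T)) ⟨
    a * fullColumns T + a * partialColumns T                        ∎
    where open ≤-Reasoning

  gap≤empty+partial : (T : Fin (a * c) → Bool) → a * c ∸ count T ≤ a * emptyColumns T + a * partialColumns T
  gap≤empty+partial T = begin
    a * c ∸ count T
      ≡⟨ cong₂ _∸_ (trans (*-comm a c) (sym (∑-const c a))) (count-columns T) ⟩
    ∑[ j < c ] a ∸ ∑[ j < c ] count (column T j)                     ≡⟨ ∑-∸ (count-≤ ∘ column T) ⟨
    ∑[ j < c ] (a ∸ count (column T j))                              ≤⟨ ∑-mono-≤ (gap-≤-empty+partial ∘ column T) ⟩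
    ∑[ j < c ] (a * empty (column T j) + a * partial (column T j))  ≡⟨ ∑-distrib-+ (λ j → a * empty (column T j)) _ ⟩
    ∑[ j < c ] (a * empty (column T j)) + ∑[ j < c ] (a * partial (column T j))
      ≡⟨ cong₂ _+_ (*-distribˡ-∑ a (empty ∘ column T)) (*-distribˡ-∑ a (partial ∘ column T)) ⟨
    a * emptyColumns T + a * partialColumns T                       ∎
    where open ≤-Reasoning

  min≤full⊓empty+partial : (T : Fin (a * c) → Bool) →
    count T ⊓ (a * c ∸ count T) ≤ a * (fullColumns T ⊓ emptyColumns T) + a * partialColumns T
  min≤full⊓empty+partial T = begin
    count T ⊓ (a * c ∸ count T)           ≤⟨ ⊓-mono-≤ (count≤full+partial T) (gap≤empty+partial T) ⟩
    (a * F + a * P) ⊓ (a * E + a * P)     ≡⟨ +-distribʳ-⊓ (a * P) (a * F) (a * E) ⟨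
    (a * F) ⊓ (a * E) + a * P             ≡⟨ cong (_+ a * P) (*-distribˡ-⊓ a F E) ⟨
    a * (F ⊓ E) + a * P                   ∎
    where
    open ≤-Reasoning
    F = fullColumns T
    E = emptyColumns T
    P = partialColumns T

  fullColumns≤row : (T : Fin (a * c) → Bool) (i : Fin a) → fullColumns T ≤ count (row T i)
  fullColumns≤row T i = ∑-mono-≤ (λ j → full≤member (column T j) i)

  emptyColumns≤gap : (T : Fin (a * c) → Bool) (i : Fin a) → emptyColumns T ≤ c ∸ count (row T i)
  emptyColumns≤gap T i = begin
    emptyColumns T                                     ≤⟨ ∑-mono-≤ (λ j → empty≤nonmember (column T j) i) ⟩
    count (not ∘ row T i)                              ≡⟨ m+n∸m≡n (count (row T i)) _ ⟨
    count (row T i) + count (not ∘ row T i) ∸ count (row T i) ≡⟨ cong (_∸ count (row T i)) (count-complement (row T i)) ⟩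
    c ∸ count (row T i)                                ∎
    where open ≤-Reasoning

  partialColumns≤exits : (T : Fin (a * c) → Bool) → partialColumns T ≤ exits (rotate ⊗ id) T
  partialColumns≤exits T = ≤-trans (∑-mono-≤ (partial≤exits ∘ column T)) (≤-reflexive (sym (exits-⊗ˡ rotate T)))

-- The discrete torus and its edge-isoperimetric inequality

volume : Vec ℕ n → ℕ
volume []       = 1
volume (k ∷ ks) = k * volume ks

shift : (ks : Vec ℕ n) → Fin n → Fin (volume ks) → Fin (volume ks)
shift (k ∷ ks) zero    = rotate ⊗ id          where open Grid k (volume ks)
shift (k ∷ ks) (suc l) = id ⊗ shift ks l      where open Grid k (volume ks)

shift-injective : (ks : Vec ℕ n) (l : Fin n) → Injective _≡_ _≡_ (shift ks l)
shift-injective (k ∷ ks) zero    = ⊗-injective rotate-injective id                 where open Grid k (volume ks)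
shift-injective (k ∷ ks) (suc l) = ⊗-injective id (shift-injective ks l)           where open Grid k (volume ks)

shift-comm : (ks : Vec ℕ n) (l l′ : Fin n) (x : Fin (volume ks)) →
  shift ks l (shift ks l′ x) ≡ shift ks l′ (shift ks l x)
shift-comm (k ∷ ks) zero    zero     x = refl
shift-comm (k ∷ ks) zero    (suc l′) x = trans (⊗-∘ rotate id id (shift ks l′) x) (sym (⊗-∘ id rotate (shift ks l′) id x))
  where open Grid k (volume ks)
shift-comm (k ∷ ks) (suc l) zero     x = trans (⊗-∘ id rotate (shift ks l) id x) (sym (⊗-∘ rotate id id (shift ks l) x))
  where open Grid k (volume ks)
shift-comm (k ∷ ks) (suc l) (suc l′) x = begin
  (id ⊗ shift ks l) ((id ⊗ shift ks l′) x) ≡⟨ ⊗-∘ id id (shift ks l) (shift ks l′) x ⟩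
  (id ⊗ shift ks l ∘ shift ks l′) x        ≡⟨ ⊗-congʳ id (shift-comm ks l l′) x ⟩
  (id ⊗ shift ks l′ ∘ shift ks l) x        ≡⟨ ⊗-∘ id id (shift ks l′) (shift ks l) x ⟨
  (id ⊗ shift ks l′) ((id ⊗ shift ks l) x) ∎
  where
  open Grid k (volume ks)
  open ≡-Reasoning

coord : (ks : Vec ℕ n) (l : Fin n) → Fin (volume ks) → Fin (lookup ks l)
coord (k ∷ ks) zero    x = proj₁ (remQuot {k} (volume ks) x)
coord (k ∷ ks) (suc l) x = coord ks l (proj₂ (remQuot {k} (volume ks) x))

coord-shift : (ks : Vec ℕ n) (l : Fin n) (x : Fin (volume ks)) → coord ks l (shift ks l x) ≡ rotate (coord ks l x)
coord-shift (k ∷ ks) zero    x = cong proj₁ (remQuot-⊗ rotate id x)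
  where open Grid k (volume ks)
coord-shift (k ∷ ks) (suc l) x = trans (cong (coord ks l ∘ proj₂) (remQuot-⊗ id (shift ks l) x)) (coord-shift ks l _)
  where open Grid k (volume ks)

coord-shift-≢ : (ks : Vec ℕ n) {l l′ : Fin n} → l ≢ l′ → (x : Fin (volume ks)) → coord ks l′ (shift ks l x) ≡ coord ks l′ x
coord-shift-≢ (k ∷ ks) {zero}  {zero}   l≢l′ x = contradiction refl l≢l′
coord-shift-≢ (k ∷ ks) {zero}  {suc l′} l≢l′ x = cong (coord ks l′ ∘ proj₂) (remQuot-⊗ rotate id x)
  where open Grid k (volume ks)
coord-shift-≢ (k ∷ ks) {suc l} {zero}   l≢l′ x = cong proj₁ (remQuot-⊗ id (shift ks l) x)
  where open Grid k (volume ks)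
coord-shift-≢ (k ∷ ks) {suc l} {suc l′} l≢l′ x =
  trans (cong (coord ks l′ ∘ proj₂) (remQuot-⊗ id (shift ks l) x)) (coord-shift-≢ ks (l≢l′ ∘ cong suc) _)
  where open Grid k (volume ks)

isoperimetry : (ks : Vec ℕ n) {K : ℕ} → All (_≤ K) ks → (T : Fin (volume ks) → Bool) →
  count T ⊓ (volume ks ∸ count T) ≤ K * ∑[ l < n ] exits (shift ks l) T
isoperimetry []       _            T with T zero
... | true  = z≤n
... | false = z≤n
-- A partial column contains an exit along the first direction, and every row contains all full and no
-- empty columns, so the induction hypothesis for the rows bounds k * (F ⊓ E).
isoperimetry {suc n} (k ∷ ks) {K} (k≤K ∷ ks≤K) T = begin
  count T ⊓ (k * volume ks ∸ count T) ≤⟨ min≤full⊓empty+partial T ⟩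
  k * (F ⊓ E) + k * P                 ≤⟨ +-mono-≤ rows-bound (*-mono-≤ k≤K (partialColumns≤exits T)) ⟩
  K * exitsₜ + K * exits₀             ≡⟨ +-comm (K * exitsₜ) (K * exits₀) ⟩
  K * exits₀ + K * exitsₜ             ≡⟨ *-distribˡ-+ K exits₀ exitsₜ ⟨
  K * (exits₀ + exitsₜ)               ∎
  where
  open ≤-Reasoning
  open Grid k (volume ks)
  F E P exits₀ exitsₜ : ℕ
  F = fullColumns T
  E = emptyColumns T
  P = partialColumns T
  exits₀ = exits (shift (k ∷ ks) zero) T
  exitsₜ = ∑[ l < n ] exits (shift (k ∷ ks) (suc l)) T

  rows-bound : k * (F ⊓ E) ≤ K * exitsₜ
  rows-bound = begin
    k * (F ⊓ E)                                                ≡⟨ ∑-const k (F ⊓ E) ⟨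
    ∑[ i < k ] (F ⊓ E)                                          ≤⟨ ∑-mono-≤ row-bound ⟩
    ∑[ i < k ] (K * ∑[ l < n ] exits (shift ks l) (row T i))    ≡⟨ *-distribˡ-∑ K (λ i → ∑[ l < n ] exits (shift ks l) (row T i)) ⟨
    K * ∑[ i < k ] ∑[ l < n ] exits (shift ks l) (row T i)      ≡⟨ cong (K *_) (∑-comm (λ i l → exits (shift ks l) (row T i))) ⟩
    K * ∑[ l < n ] ∑[ i < k ] exits (shift ks l) (row T i)      ≡⟨ cong (K *_) (sum-cong-≗ (λ l → exits-⊗ʳ (shift ks l) T)) ⟨
    K * exitsₜ                                                 ∎
    where
    row-bound : ∀ i → F ⊓ E ≤ K * ∑[ l < n ] exits (shift ks l) (row T i)
    row-bound i = ≤-trans (⊓-mono-≤ (fullColumns≤row T i) (emptyColumns≤gap T i)) (isoperimetry ks ks≤K (row T i))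

-- Flows graded modulo 3

data ℤ₃ : Set where
  0₃ 1₃ 2₃ : ℤ₃

suc₃ : ℤ₃ → ℤ₃
suc₃ 0₃ = 1₃
suc₃ 1₃ = 2₃
suc₃ 2₃ = 0₃

infixl 6 _+₃_

_+₃_ : ℤ₃ → ℤ₃ → ℤ₃
0₃ +₃ v = v
1₃ +₃ v = suc₃ v
2₃ +₃ v = suc₃ (suc₃ v)

suc₃-injective : Injective _≡_ _≡_ suc₃
suc₃-injective {0₃} {0₃} _ = refl
suc₃-injective {1₃} {1₃} _ = refl
suc₃-injective {2₃} {2₃} _ = refl

suc₃-+₃ : ∀ u v → suc₃ u +₃ v ≡ suc₃ (u +₃ v)
suc₃-+₃ 0₃ v  = refl
suc₃-+₃ 1₃ v  = refl
suc₃-+₃ 2₃ 0₃ = refl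
suc₃-+₃ 2₃ 1₃ = refl
suc₃-+₃ 2₃ 2₃ = refl

+₃-suc₃ : ∀ u v → u +₃ suc₃ v ≡ suc₃ (u +₃ v)
+₃-suc₃ 0₃ v = refl
+₃-suc₃ 1₃ v = refl
+₃-suc₃ 2₃ v = refl

mod₃ : ℕ → ℤ₃
mod₃ zero    = 0₃
mod₃ (suc n) = suc₃ (mod₃ n)

mod₃-*3 : ∀ a → mod₃ (a * 3) ≡ 0₃
mod₃-*3 zero    = refl
mod₃-*3 (suc a) = cong (suc₃ ∘ suc₃ ∘ suc₃) (mod₃-*3 a)

mod₃-divisible : 3 ∣ n → mod₃ n ≡ 0₃
mod₃-divisible (divides a refl) = mod₃-*3 a

mod₃-rotate : mod₃ n ≡ 0₃ → (i : Fin n) → mod₃ (toℕ (rotate i)) ≡ suc₃ (mod₃ (toℕ i))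
mod₃-rotate {suc n} n≡0 i with toℕ i ≟ n
... | yes i≡n = trans (cong (mod₃ ∘ toℕ) (rotate-last i i≡n)) (sym (trans (cong (suc₃ ∘ mod₃) i≡n) n≡0))
... | no  i≢n = cong mod₃ (toℕ-rotate i i≢n)

direction : ∀ {r′} → ℤ₃ → Fin (3 + r′)
direction 0₃ = zero
direction 1₃ = suc zero
direction 2₃ = suc (suc zero)

module Flows {r′ : ℕ} (sides : Vec ℕ (3 + r′)) (divisible : ∀ u → 3 ∣ lookup sides (direction u)) where

  N : ℕ
  N = volume sides

  residue : ℤ₃ → Fin N → ℤ₃
  residue u x = mod₃ (toℕ (coord sides (direction u) x))

  residue-shift : ∀ u x → residue u (shift sides (direction u) x) ≡ suc₃ (residue u x)
  residue-shift u x = trans (cong (mod₃ ∘ toℕ) (coord-shift sides (direction u) x))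
                            (mod₃-rotate (mod₃-divisible (divisible u)) (coord sides (direction u) x))

  residue-shift-≢ : ∀ u v → direction u ≢ direction v → ∀ x → residue v (shift sides (direction u) x) ≡ residue v x
  residue-shift-≢ u v u≢v x = cong (mod₃ ∘ toℕ) (coord-shift-≢ sides u≢v x)

  grade : Fin N → ℤ₃
  grade x = residue 0₃ x +₃ (residue 1₃ x +₃ residue 2₃ x)

  grade-shift : ∀ u x → grade (shift sides (direction u) x) ≡ suc₃ (grade x)
  grade-shift 0₃ x = trans
    (cong₂ _+₃_ (residue-shift 0₃ x) (cong₂ _+₃_ (residue-shift-≢ 0₃ 1₃ (λ ()) x) (residue-shift-≢ 0₃ 2₃ (λ ()) x)))
    (suc₃-+₃ (residue 0₃ x) _)
  grade-shift 1₃ x = trans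
    (cong₂ _+₃_ (residue-shift-≢ 1₃ 0₃ (λ ()) x) (cong₂ _+₃_ (residue-shift 1₃ x) (residue-shift-≢ 1₃ 2₃ (λ ()) x)))
    (trans (cong (residue 0₃ x +₃_) (suc₃-+₃ (residue 1₃ x) _)) (+₃-suc₃ (residue 0₃ x) _))
  grade-shift 2₃ x = trans
    (cong₂ _+₃_ (residue-shift-≢ 2₃ 0₃ (λ ()) x) (cong₂ _+₃_ (residue-shift-≢ 2₃ 1₃ (λ ()) x) (residue-shift 2₃ x)))
    (trans (cong (residue 0₃ x +₃_) (+₃-suc₃ (residue 1₃ x) _)) (+₃-suc₃ (residue 0₃ x) _))

  flow : ℤ₃ → Fin N → Fin N
  flow j x = shift sides (direction (grade x +₃ j)) x

  grade-flow : ∀ j x → grade (flow j x) ≡ suc₃ (grade x)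
  grade-flow j x = grade-shift (grade x +₃ j) x

  flow-injective : ∀ j → Injective _≡_ _≡_ (flow j)
  flow-injective j {x} {y} eq = shift-injective sides (direction (grade x +₃ j))
    (trans eq (cong (λ u → shift sides (direction (u +₃ j)) y) (sym same-grade)))
    where
    same-grade : grade x ≡ grade y
    same-grade = suc₃-injective (trans (sym (grade-flow j x)) (trans (cong grade eq) (grade-flow j y)))

  -- Every graded shift raises the grade by one, so both sides perform the same two commuting shifts.
  flow-square : ∀ x → flow 0₃ (flow 2₃ x) ≡ flow 1₃ (flow 1₃ x)
  flow-square x = begin
    flow 0₃ (flow 2₃ x)
      ≡⟨ cong (λ u → shift sides (direction (u +₃ 0₃)) (flow 2₃ x)) (grade-flow 2₃ x) ⟩
    shift sides (direction (suc₃ (grade x) +₃ 0₃)) (shift sides (direction (grade x +₃ 2₃)) x)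
      ≡⟨ square (grade x) ⟩
    shift sides (direction (suc₃ (grade x) +₃ 1₃)) (shift sides (direction (grade x +₃ 1₃)) x)
      ≡⟨ cong (λ u → shift sides (direction (u +₃ 1₃)) (flow 1₃ x)) (grade-flow 1₃ x) ⟨
    flow 1₃ (flow 1₃ x) ∎
    where
    open ≡-Reasoning
    square : ∀ u → shift sides (direction (suc₃ u +₃ 0₃)) (shift sides (direction (u +₃ 2₃)) x)
                 ≡ shift sides (direction (suc₃ u +₃ 1₃)) (shift sides (direction (u +₃ 1₃)) x)
    square 0₃ = shift-comm sides (direction 1₃) (direction 2₃) x
    square 1₃ = shift-comm sides (direction 2₃) (direction 0₃) x
    square 2₃ = shift-comm sides (direction 0₃) (direction 1₃) x

  exits-flows : ∀ T → exits (shift sides (direction 0₃)) T + (exits (shift sides (direction 1₃)) T + exits (shift sides (direction 2₃)) T)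
                    ≡ exits (flow 0₃) T + (exits (flow 1₃) T + exits (flow 2₃) T)
  exits-flows T = begin
    sum (leave 0₃) + (sum (leave 1₃) + sum (leave 2₃))
      ≡⟨ cong (sum (leave 0₃) +_) (∑-distrib-+ (leave 1₃) (leave 2₃)) ⟨
    sum (leave 0₃) + ∑[ x < N ] (leave 1₃ x + leave 2₃ x)
      ≡⟨ ∑-distrib-+ (leave 0₃) (λ x → leave 1₃ x + leave 2₃ x) ⟨
    ∑[ x < N ] (leave 0₃ x + (leave 1₃ x + leave 2₃ x))
      ≡⟨ sum-cong-≗ (λ x → rotate-terms (λ u → leave u x) (grade x)) ⟩
    ∑[ x < N ] (leaveᶠ 0₃ x + (leaveᶠ 1₃ x + leaveᶠ 2₃ x))
      ≡⟨ ∑-distrib-+ (leaveᶠ 0₃) (λ x → leaveᶠ 1₃ x + leaveᶠ 2₃ x) ⟩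
    sum (leaveᶠ 0₃) + ∑[ x < N ] (leaveᶠ 1₃ x + leaveᶠ 2₃ x)
      ≡⟨ cong (sum (leaveᶠ 0₃) +_) (∑-distrib-+ (leaveᶠ 1₃) (leaveᶠ 2₃)) ⟩
    sum (leaveᶠ 0₃) + (sum (leaveᶠ 1₃) + sum (leaveᶠ 2₃)) ∎
    where
    open ≡-Reasoning
    leave leaveᶠ : ℤ₃ → Fin N → ℕ
    leave  u x = indicator (T x ∧ not (T (shift sides (direction u) x)))
    leaveᶠ j x = leave (grade x +₃ j) x
    rotate-terms : (A : ℤ₃ → ℕ) (u : ℤ₃) → A 0₃ + (A 1₃ + A 2₃) ≡ A (u +₃ 0₃) + (A (u +₃ 1₃) + A (u +₃ 2₃))
    rotate-terms A 0₃ = refl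
    rotate-terms A 1₃ = trans (+-comm (A 0₃) _) (+-assoc (A 1₃) (A 2₃) (A 0₃))
    rotate-terms A 2₃ = trans (sym (+-assoc (A 0₃) (A 1₃) (A 2₃))) (+-comm (A 0₃ + A 1₃) (A 2₃))

  -- One map per direction, the identity included: the two flows stand in for the three graded directions.
  move : Fin (3 + r′) → Fin N → Fin N
  move zero                = id
  move (suc zero)          = flow 1₃
  move (suc (suc zero))    = flow 2₃
  move (suc (suc (suc l))) = shift sides (suc (suc (suc l)))

  move-injective : ∀ i → Injective _≡_ _≡_ (move i)
  move-injective zero                = id
  move-injective (suc zero)          = flow-injective 1₃
  move-injective (suc (suc zero))    = flow-injective 2₃
  move-injective (suc (suc (suc l))) = shift-injective sides (suc (suc (suc l)))

  ∑exits-shift≤ : ∀ T L → (∀ i → exits (move i) T ≤ L) → ∑[ l < 3 + r′ ] exits (shift sides l) T ≤ (5 + r′) * L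
  ∑exits-shift≤ T L exits≤L = begin
    e₀ + (e₁ + (e₂ + R))      ≡⟨ cong (e₀ +_) (+-assoc e₁ e₂ R) ⟨
    e₀ + (e₁ + e₂ + R)        ≡⟨ +-assoc e₀ (e₁ + e₂) R ⟨
    e₀ + (e₁ + e₂) + R        ≡⟨ cong (_+ R) (exits-flows T) ⟩
    f₀ + (f₁ + f₂) + R        ≤⟨ +-mono-≤ (+-mono-≤ f₀≤ (+-mono-≤ f₁≤L f₂≤L)) R≤ ⟩
    (L + L + L) + (L + L) + r′ * L ≡⟨ solve 2 (λ L r → (L :+ L :+ L) :+ (L :+ L) :+ r :* L := (con 5 :+ r) :* L) refl L r′ ⟩
    (5 + r′) * L              ∎
    where
    open ≤-Reasoning
    e₀ e₁ e₂ R f₀ f₁ f₂ : ℕ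
    e₀ = exits (shift sides (direction 0₃)) T
    e₁ = exits (shift sides (direction 1₃)) T
    e₂ = exits (shift sides (direction 2₃)) T
    R  = ∑[ l < r′ ] exits (shift sides (suc (suc (suc l)))) T
    f₀ = exits (flow 0₃) T
    f₁ = exits (flow 1₃) T
    f₂ = exits (flow 2₃) T
    f₁≤L = exits≤L (suc zero)
    f₂≤L = exits≤L (suc (suc zero))
    f₀≤ : f₀ ≤ L + L + L
    f₀≤ = ≤-trans (exits-∘ T (flow-injective 1₃) (flow-injective 2₃) flow-square) (+-mono-≤ (+-mono-≤ f₂≤L f₁≤L) f₁≤L)
    R≤ : R ≤ r′ * L
    R≤ = ≤-trans (∑-mono-≤ {n = r′} (λ l → exits≤L (suc (suc (suc l))))) (≤-reflexive (∑-const r′ L))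

  expansion : ∀ {K S} .{{_ : NonZero K}} → All (_≤ K) sides → (T : Fin N → Bool) →
    (5 + r′) * K * S ≤ count T → (5 + r′) * K * S ≤ N ∸ count T → OuterBoundary move T S
  expansion {K} {S} sides≤K T big small with any? (λ i → S ≤? exits (move i) T)
  ... | yes (i , S≤exits) = exits⇒outerBoundary move T i (move-injective i) S≤exits
  ... | no  ∄i            = contradiction S≤pred[S] (<⇒≱ (≤-reflexive (suc-pred S {{>-nonZero 0<S}})))
    where
    exits<S : ∀ i → exits (move i) T < S
    exits<S i = ≰⇒> (∄i ∘ (i ,_))
    0<S : 0 < S
    0<S = ≤-<-trans z≤n (exits<S zero)
    instance
      _ : NonZero ((5 + r′) * K)
      _ = m*n≢0 (5 + r′) K
    S≤pred[S] : S ≤ pred S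
    S≤pred[S] = *-cancelˡ-≤ ((5 + r′) * K) (begin
      (5 + r′) * K * S                      ≤⟨ ⊓-glb big small ⟩
      count T ⊓ (N ∸ count T)               ≤⟨ isoperimetry sides sides≤K T ⟩
      K * ∑[ l < 3 + r′ ] exits (shift sides l) T ≤⟨ *-monoʳ-≤ K (∑exits-shift≤ T (pred S) (<⇒≤pred ∘ exits<S)) ⟩
      K * ((5 + r′) * pred S)               ≡⟨ solve 3 (λ K r s → K :* ((con 5 :+ r) :* s) := (con 5 :+ r) :* K :* s) refl K r′ (pred S) ⟩
      (5 + r′) * K * pred S                 ∎)
      where
      open ≤-Reasoning

-- The matchings

module Construction {r m : ℕ} (F : Fin (suc r) → Fin m → Fin m) where

  edge : Bool → Fin m → Edge (suc r)
  edge false k _ = toℕ k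
  edge true  k i = toℕ (F i k)

  edge-zero : (∀ k → F zero k ≡ k) → ∀ b k → edge b k zero ≡ toℕ k
  edge-zero F₀≗id false k = refl
  edge-zero F₀≗id true  k = cong toℕ (F₀≗id k)

  edge-disjoint : (∀ i → Injective _≡_ _≡_ (F i)) → ∀ b {k l} → k ≢ l → Disjoint (edge b k) (edge b l)
  edge-disjoint F-inj false k≢l i = k≢l ∘ toℕ-injective
  edge-disjoint F-inj true  k≢l i = k≢l ∘ F-inj i ∘ toℕ-injective

  matching : Bool → List (Edge (suc r))
  matching b = tabulate (edge b)

  matching-isMatching : (∀ i → Injective _≡_ _≡_ (F i)) → ∀ b → IsMatching (matching b)
  matching-isMatching F-inj b = allPairs-tabulate⁺ (edge-disjoint F-inj b)

  matching-length : ∀ b → length (matching b) ≡ m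
  matching-length b = length-tabulate (edge b)

  twisted? : ∀ {t} c → Fin (c + t) → Bool
  twisted? c j = [ const false , const true ]′ (splitAt c j)

  count-twisted? : ∀ c t → count (twisted? {t} c) ≡ t
  count-twisted? c t = begin
    count (twisted? c)
      ≡⟨ ∑-split c t (indicator ∘ twisted? c) ⟩
    ∑[ j < c ] indicator (twisted? c (j ↑ˡ t)) + ∑[ j < t ] indicator (twisted? c (c ↑ʳ j))
      ≡⟨ cong₂ _+_ (count-false _ (λ j → cong [ const false , const true ]′ (splitAt-↑ˡ c j t)))
                   (count-true _ (λ j → cong [ const false , const true ]′ (splitAt-↑ʳ c t j))) ⟩
    0 + t ∎
    where open ≡-Reasoning

  collection : ∀ {t} c → Fin (c + t) → List (Edge (suc r))
  collection c j = matching (twisted? c j)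

  no-rainbow : ∀ {t} c {S} → (∀ k → F zero k ≡ k) → (∀ i → Injective _≡_ _≡_ (F i)) →
    (∀ T → count T ≡ t → OuterBoundary F T S) → m < c + t + S →
    ¬ RainbowMatching (c + t) (collection c) (c + t)
  no-rainbow {t} c {S} F₀≗id F-inj boundary m<n+S (g , φ , φ-inj , g-disjoint , g∈) =
    contradiction (injective⇒≤ used-injective) (<⇒≱ m<n+S)
    where
    twisted : Fin (c + t) → Bool
    twisted a = twisted? c (φ a)

    slot : Fin (c + t) → Fin m
    slot a = proj₁ (∈-tabulate⁻ (g∈ a))

    g-at : ∀ a i → g a i ≡ edge (twisted a) (slot a) i
    g-at a i = cong (λ e → e i) (proj₂ (∈-tabulate⁻ (g∈ a)))

    slot-injective : Injective _≡_ _≡_ slot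
    slot-injective {a} {b} eq with a Fin.≟ b
    ... | yes a≡b = a≡b
    ... | no  a≢b = contradiction same-vertex (g-disjoint a b a≢b zero)
      where
      same-vertex : g a zero ≡ g b zero
      same-vertex = begin
        g a zero                             ≡⟨ g-at a zero ⟩
        edge (twisted a) (slot a) zero       ≡⟨ edge-zero F₀≗id (twisted a) (slot a) ⟩
        toℕ (slot a)                         ≡⟨ cong toℕ eq ⟩
        toℕ (slot b)                         ≡⟨ edge-zero F₀≗id (twisted b) (slot b) ⟨
        edge (twisted b) (slot b) zero       ≡⟨ g-at b zero ⟨
        g b zero                             ∎
        where open ≡-Reasoning

    occupied : Fin m → Bool
    occupied = image slot twisted

    count-twisted : count twisted ≡ t
    count-twisted = trans (count-∘-injective (twisted? c) φ-inj) (count-twisted? c t)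

    open OuterBoundary (boundary occupied (trans (count-image slot-injective twisted) count-twisted))

    point≢slot : ∀ s a → point s ≢ slot a
    point≢slot s a eq = by-kind (twisted a) refl
      where
      by-kind : ∀ b → twisted a ≡ b → ⊥
      by-kind true  tw = contradiction (trans (sym (point-outside s)) (trans (cong occupied eq) (image-intro slot twisted a tw))) λ ()
      by-kind false tw = contradiction same-vertex (g-disjoint a a′ a≢a′ i)
        where
        i = proj₁ (point-reached s)
        y = proj₁ (proj₂ (point-reached s))
        owner = image-witness slot twisted y (proj₁ (proj₂ (proj₂ (point-reached s))))
        a′ = proj₁ owner
        a≢a′ : a ≢ a′
        a≢a′ a≡a′ = contradiction (trans (sym tw) (trans (cong twisted a≡a′) (proj₁ (proj₂ owner)))) λ ()
        same-vertex : g a i ≡ g a′ i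
        same-vertex = begin
          g a i                    ≡⟨ trans (g-at a i) (cong (λ b → edge b (slot a) i) tw) ⟩
          toℕ (slot a)             ≡⟨ cong toℕ (trans (sym eq) (proj₂ (proj₂ (proj₂ (point-reached s))))) ⟩
          toℕ (F i y)              ≡⟨ cong (toℕ ∘ F i) (proj₂ (proj₂ owner)) ⟨
          toℕ (F i (slot a′))      ≡⟨ trans (g-at a′ i) (cong (λ b → edge b (slot a′) i) (proj₁ (proj₂ owner))) ⟨
          g a′ i                   ∎
          where open ≡-Reasoning

    used : Fin (c + t + S) → Fin m
    used x = [ slot , point ]′ (splitAt (c + t) x)

    used-injective : Injective _≡_ _≡_ used
    used-injective {x} {y} eq = begin
      x                   ≡⟨ join-splitAt (c + t) S x ⟨
      join (c + t) S (splitAt (c + t) x) ≡⟨ cong (join (c + t) S) (same-part (splitAt (c + t) x) (splitAt (c + t) y) eq) ⟩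
      join (c + t) S (splitAt (c + t) y) ≡⟨ join-splitAt (c + t) S y ⟩
      y                   ∎
      where
      open ≡-Reasoning
      same-part : ∀ u v → [ slot , point ]′ u ≡ [ slot , point ]′ v → u ≡ v
      same-part (inj₁ a) (inj₁ b) eq = cong inj₁ (slot-injective eq)
      same-part (inj₁ a) (inj₂ s) eq = contradiction (sym eq) (point≢slot s a)
      same-part (inj₂ s) (inj₁ a) eq = contradiction eq (point≢slot s a)
      same-part (inj₂ s) (inj₂ s′) eq = cong inj₂ (point-injective eq)

module Padding {r M : ℕ} (f : ℕ) (F : Fin r → Fin M → Fin M) where

  pad : Fin r → Fin (M + f) → Fin (M + f)
  pad i = join M f ∘ Sum.map₁ (F i) ∘ splitAt M

  pad-↑ˡ : ∀ i p → pad i (p ↑ˡ f) ≡ F i p ↑ˡ f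
  pad-↑ˡ i p = cong (join M f ∘ Sum.map₁ (F i)) (splitAt-↑ˡ M p f)

  pad-identity : ∀ i → (∀ p → F i p ≡ p) → ∀ x → pad i x ≡ x
  pad-identity i F≗id x = trans (cong (join M f) (Sum.map₁-cong F≗id (splitAt M x)))
                                (trans (cong (join M f) (Sum.map-id (splitAt M x))) (join-splitAt M f x))

  pad-injective : ∀ i → Injective _≡_ _≡_ (F i) → Injective _≡_ _≡_ (pad i)
  pad-injective i F-inj {x} {y} eq = begin
    x                      ≡⟨ join-splitAt M f x ⟨
    join M f (splitAt M x) ≡⟨ cong (join M f) (map₁-injective (splitAt M x) (splitAt M y) same) ⟩
    join M f (splitAt M y) ≡⟨ join-splitAt M f y ⟩
    y                      ∎
    where
    open ≡-Reasoning
    same : Sum.map₁ (F i) (splitAt M x) ≡ Sum.map₁ (F i) (splitAt M y)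
    same = trans (sym (splitAt-join M f _)) (trans (cong (splitAt M) eq) (splitAt-join M f _))
    map₁-injective : ∀ u v → Sum.map₁ (F i) u ≡ Sum.map₁ (F i) v → u ≡ v
    map₁-injective (inj₁ p) (inj₁ q) eq = cong inj₁ (F-inj (Sum.inj₁-injective eq))
    map₁-injective (inj₂ p) (inj₂ q) eq = eq

  pad-outerBoundary : ∀ {t S} → (∀ T → t ∸ f ≤ count T → count T ≤ t → OuterBoundary F T S) →
    ∀ T′ → count T′ ≡ t → OuterBoundary pad T′ S
  pad-outerBoundary {t} {S} boundary T′ |T′|≡t = record
    { point           = λ s → point s ↑ˡ f
    ; point-injective = point-injective ∘ ↑ˡ-injective f _ _
    ; point-outside   = point-outside
    ; point-reached   = λ s → let i , y , Ty , eq = point-reached s in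
                          i , y ↑ˡ f , Ty , trans (cong (_↑ˡ f) eq) (sym (pad-↑ˡ i y))
    }
    where
    T₀ : Fin M → Bool
    T₀ p = T′ (p ↑ˡ f)
    split : count T₀ + count (λ q → T′ (M ↑ʳ q)) ≡ t
    split = trans (sym (∑-split M f (indicator ∘ T′))) |T′|≡t
    open OuterBoundary (boundary T₀
      (m≤n+o⇒m∸n≤o t f (≤-trans (≤-reflexive (sym split))
        (≤-trans (+-monoʳ-≤ (count T₀) (count-≤ _)) (≤-reflexive (+-comm (count T₀) f)))))
      (≤-trans (m≤m+n (count T₀) _) (≤-reflexive split)))

Counterexample : ℕ → ℕ → Set
Counterexample r n =
  Σ ℕ λ m →
    n ≤ m + 1 ×
    n ^ (r ∸ 1) ≤ (12 * r * (m + 1 ∸ n)) ^ r ×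
    Σ (Fin n → List (Edge r)) λ Ms →
      (∀ i → IsMatching (Ms i) × length (Ms i) ≡ m) ×
      ¬ RainbowMatching n Ms n

counterexample : ∀ {r m} c t S (F : Fin (suc r) → Fin m → Fin m) → (∀ k → F zero k ≡ k) → (∀ i → Injective _≡_ _≡_ (F i)) →
  (∀ T → count T ≡ t → OuterBoundary F T S) → m + 1 ≡ c + t + S →
  (c + t) ^ r ≤ (12 * suc r * S) ^ suc r → Counterexample (suc r) (c + t)
counterexample {r} {m} c t S F F₀≗id F-inj boundary m+1≡n+S S-large =
  m , n≤m+1 , subst (λ x → (c + t) ^ r ≤ (12 * suc r * x) ^ suc r) (sym gap≡S) S-large ,
  collection c , (λ j → matching-isMatching F-inj (twisted? c j) , matching-length (twisted? c j)) ,
  no-rainbow c F₀≗id F-inj boundary (≤-reflexive (trans (+-comm 1 m) m+1≡n+S))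
  where
  open Construction F
  n≤m+1 : c + t ≤ m + 1
  n≤m+1 = ≤-trans (m≤m+n (c + t) S) (≤-reflexive (sym m+1≡n+S))
  gap≡S : m + 1 ∸ (c + t) ≡ S
  gap≡S = trans (cong (_∸ (c + t)) m+1≡n+S) (m+n∸m≡n (c + t) S)

record TorusDesign (r′ n : ℕ) : Set where
  field
    sides     : Vec ℕ (3 + r′)
    divisible : ∀ u → 3 ∣ lookup sides (direction u)
    K S padding diagonal twisted : ℕ
    overlap {{K≢0}} : NonZero K
    sides≤K  : All (_≤ K) sides
    n≡       : diagonal + twisted ≡ n
    size     : volume sides + padding + 1 ≡ n + S
    interior : (5 + r′) * K * S ≤ twisted ∸ padding
    exterior : (5 + r′) * K * S ≤ volume sides ∸ twisted
    S-large  : n ^ (2 + r′) ≤ (12 * (3 + r′) * S) ^ (3 + r′)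

design⇒counterexample : ∀ {r′ n} → TorusDesign r′ n → Counterexample (3 + r′) n
design⇒counterexample {r′} design = subst (Counterexample (3 + r′)) n≡
  (counterexample diagonal twisted S pad (pad-identity zero (λ _ → refl)) (λ i → pad-injective i (move-injective i))
    (pad-outerBoundary (λ T lo hi → expansion sides≤K T (≤-trans interior lo) (≤-trans exterior (∸-monoʳ-≤ N hi))))
    (trans size (cong (_+ S) (sym n≡)))
    (subst (λ x → x ^ (2 + r′) ≤ (12 * (3 + r′) * S) ^ (3 + r′)) (sym n≡) S-large))
  where
  open TorusDesign design
  open Flows sides divisible
  open Padding padding move

small-case : ∀ n → 2 ≤ n → n ^ 2 ≤ (12 * 3 * 2) ^ 3 → Counterexample 3 n
small-case (suc (suc c)) (s≤s (s≤s z≤n)) S-large = subst (Counterexample 3) (+-comm (suc c) 1)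
  (counterexample (suc c) 1 2 F (λ _ → refl) F-injective boundary size
    (subst (λ x → x ^ 2 ≤ (12 * 3 * 2) ^ 3) (+-comm 1 (suc c)) S-large))
  where
  F : Fin 3 → Fin (3 + c) → Fin (3 + c)
  F zero             x = x
  F (suc zero)       x = rotate x
  F (suc (suc zero)) x = rotate (rotate x)

  F-injective : ∀ i → Injective _≡_ _≡_ (F i)
  F-injective zero             = λ eq → eq
  F-injective (suc zero)       = rotate-injective
  F-injective (suc (suc zero)) = rotate-injective ∘ rotate-injective

  size : 3 + c + 1 ≡ suc c + 1 + 2
  size = cong suc (+-comm 2 (c + 1))

  boundary : ∀ T → count T ≡ 1 → OuterBoundary F T 2
  boundary T |T|≡1 = record
    { point           = point
    ; point-injective = point-injective
    ; point-outside   = λ s → count≡1⇒unique T |T|≡1 Ty (point≢y s)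
    ; point-reached   = λ { zero → suc zero , y , Ty , refl ; (suc zero) → suc (suc zero) , y , Ty , refl }
    }
    where
    y : Fin (3 + c)
    y = enumerate T (subst Fin (sym |T|≡1) zero)
    Ty : T y ≡ true
    Ty = enumerate-sound T _
    point : Fin 2 → Fin (3 + c)
    point zero       = rotate y
    point (suc zero) = rotate (rotate y)
    point≢y : ∀ s → point s ≢ y
    point≢y zero       = rotate-≢ y
    point≢y (suc zero) = rotate²-≢ y
    point-injective : Injective _≡_ _≡_ point
    point-injective {zero}     {zero}     _  = refl
    point-injective {zero}     {suc zero} eq = contradiction (sym (rotate-injective eq)) (rotate-≢ y)
    point-injective {suc zero} {zero}     eq = contradiction (rotate-injective eq) (rotate-≢ y)
    point-injective {suc zero} {suc zero} _  = refl

-- Choice of the parameters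

integer-root : ∀ r .{{_ : NonZero r}} n → ∃ λ k → k ^ r ≤ n × n < suc k ^ r
integer-root r@(suc _) zero = 0 , z≤n , m^n>0 1 r
integer-root r (suc n) with integer-root r n
... | k , k^r≤n , n<[1+k]^r with suc n <? suc k ^ r
...   | yes 1+n<[1+k]^r = k , m≤n⇒m≤1+n k^r≤n , 1+n<[1+k]^r
...   | no  1+n≮[1+k]^r = suc k , ≤-reflexive [1+k]^r≡1+n , <-≤-trans (s≤s (≤-reflexive (sym [1+k]^r≡1+n))) (^-monoˡ-< r (n<1+n (suc k)))
  where
  [1+k]^r≡1+n : suc k ^ r ≡ suc n
  [1+k]^r≡1+n = ≤-antisym (s≤s⁻¹ (≰⇒> 1+n≮[1+k]^r)) n<[1+k]^r

root-≥ : ∀ r .{{_ : NonZero r}} {n k} c → c ^ r ≤ n → n < suc k ^ r → c ≤ k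
root-≥ r {n} {k} c c^r≤n n<[1+k]^r with c ≤? k
... | yes c≤k = c≤k
... | no  c≰k = contradiction (^-monoˡ-≤ r (≰⇒> c≰k)) (<⇒≱ (≤-<-trans c^r≤n n<[1+k]^r))

last-satisfying : ∀ {ℓ} {P : Pred ℕ ℓ} → Decidable P → P 0 → ∀ len →
  ∃ λ i → i ≤ len × P i × (i ≡ len ⊎ i < len × ¬ P (suc i))
last-satisfying P? P0 zero = 0 , z≤n , P0 , inj₁ refl
last-satisfying P? P0 (suc len) with last-satisfying P? P0 len
... | i , i≤len , Pi , inj₂ (i<len , ¬P[1+i]) = i , m≤n⇒m≤1+n i≤len , Pi , inj₂ (m<n⇒m<1+n i<len , ¬P[1+i])
... | i , i≤len , Pi , inj₁ refl with P? (suc i)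
...   | yes P[1+i] = suc i , ≤-refl , P[1+i] , inj₁ refl
...   | no  ¬P[1+i] = i , n≤1+n i , Pi , inj₂ (n<1+n i , ¬P[1+i])

division : ∀ m d .{{_ : NonZero d}} → d * (m / d) ≤ m × m < d * suc (m / d)
division m d = ≤-trans (≤-reflexive (*-comm d (m / d))) (m/n*n≤m m d) , (begin-strict
  m                     ≡⟨ m≡m%n+[m/n]*n m d ⟩
  m % d + m / d * d     <⟨ +-monoˡ-< (m / d * d) (m%n<n m d) ⟩
  d + m / d * d         ≡⟨ cong (d +_) (*-comm (m / d) d) ⟩
  d + d * (m / d)       ≡⟨ *-suc d (m / d) ⟨
  d * suc (m / d)       ∎)
  where open ≤-Reasoning

*-distribʳ-^ : ∀ a b r → (a * b) ^ r ≡ a ^ r * b ^ r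
*-distribʳ-^ a b zero    = refl
*-distribʳ-^ a b (suc r) = trans (cong (a * b *_) (*-distribʳ-^ a b r)) (*-interchange a b (a ^ r) (b ^ r))

volume-∷ʳ : ∀ {d} (ks : Vec ℕ d) x → volume (ks ∷ʳ x) ≡ volume ks * x
volume-∷ʳ []       x = trans (*-identityʳ x) (sym (+-identityʳ x))
volume-∷ʳ (k ∷ ks) x = trans (cong (k *_) (volume-∷ʳ ks x)) (sym (*-assoc k (volume ks) x))

All-∷ʳ : ∀ {ℓ} {P : Pred ℕ ℓ} {d} {xs : Vec ℕ d} {x} → All P xs → P x → All P (xs ∷ʳ x)
All-∷ʳ []         Px = Px ∷ []
All-∷ʳ (Py ∷ Pxs) Px = Py ∷ All-∷ʳ Pxs Px

divisible-∷ʳ : ∀ {r′} (xs : Vec ℕ (3 + r′)) x → All (3 ∣_) xs → ∀ u → 3 ∣ lookup (xs ∷ʳ x) (direction u)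
divisible-∷ʳ (a ∷ b ∷ c ∷ _) x (3∣a ∷ 3∣b ∷ 3∣c ∷ _) 0₃ = 3∣a
divisible-∷ʳ (a ∷ b ∷ c ∷ _) x (3∣a ∷ 3∣b ∷ 3∣c ∷ _) 1₃ = 3∣b
divisible-∷ʳ (a ∷ b ∷ c ∷ _) x (3∣a ∷ 3∣b ∷ 3∣c ∷ _) 2₃ = 3∣c

divisible-∷ʳ-last : (xs : Vec ℕ 2) → ∀ x → All (3 ∣_) xs → 3 ∣ x → ∀ u → 3 ∣ lookup (xs ∷ʳ x) (direction u)
divisible-∷ʳ-last (a ∷ b ∷ []) x (3∣a ∷ 3∣b ∷ []) 3∣x 0₃ = 3∣a
divisible-∷ʳ-last (a ∷ b ∷ []) x (3∣a ∷ 3∣b ∷ []) 3∣x 1₃ = 3∣b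
divisible-∷ʳ-last (a ∷ b ∷ []) x (3∣a ∷ 3∣b ∷ []) 3∣x 2₃ = 3∣x

module Chain (b : ℕ) where

  chain : (len i : ℕ) → Vec ℕ len
  chain zero      i       = []
  chain (suc len) zero    = b ∷ chain len zero
  chain (suc len) (suc i) = b + 3 ∷ chain len i

  volume-chain-zero : ∀ len → volume (chain len 0) ≡ b ^ len
  volume-chain-zero zero      = refl
  volume-chain-zero (suc len) = cong (b *_) (volume-chain-zero len)

  volume-chain-all : ∀ len → volume (chain len len) ≡ (b + 3) ^ len
  volume-chain-all zero      = refl
  volume-chain-all (suc len) = cong ((b + 3) *_) (volume-chain-all len)

  volume-chain-suc : ∀ {len i} → i < len → b * volume (chain len (suc i)) ≡ (b + 3) * volume (chain len i)
  volume-chain-suc {suc len} {zero}  _         = *-lcomm b (b + 3) (volume (chain len 0))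
  volume-chain-suc {suc len} {suc i} (s≤s i<len) = begin
    b * ((b + 3) * volume (chain len (suc i))) ≡⟨ *-lcomm b (b + 3) _ ⟩
    (b + 3) * (b * volume (chain len (suc i))) ≡⟨ cong ((b + 3) *_) (volume-chain-suc i<len) ⟩
    (b + 3) * ((b + 3) * volume (chain len i)) ∎
    where open ≡-Reasoning

  chain-all : ∀ {ℓ} {P : Pred ℕ ℓ} → P b → P (b + 3) → ∀ len i → All P (chain len i)
  chain-all Pb Pb+3 zero      i       = []
  chain-all Pb Pb+3 (suc len) zero    = Pb ∷ chain-all Pb Pb+3 len zero
  chain-all Pb Pb+3 (suc len) (suc i) = Pb+3 ∷ chain-all Pb Pb+3 len i

module Parameters (r′ n k : ℕ) (k^r≤n : k ^ (3 + r′) ≤ n) (n<[1+k]^r : n < suc k ^ (3 + r′)) (6≤k : 6 ≤ k) where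

  r len D : ℕ
  r   = 3 + r′
  len = 2 + r′
  D   = 12 * r * k

  instance
    k≢0 : NonZero k
    k≢0 = >-nonZero (≤-trans (s≤s z≤n) 6≤k)
    D≢0 : NonZero D
    D≢0 = m*n≢0 (12 * r) k
    K≢0 : NonZero (2 * k)
    K≢0 = m*n≢0 2 k

  -- S is the least surplus with n < D * S, which gives S-large. The torus has len sides b or b + 3, and
  -- one last side L chosen in LastSide; K bounds all of them.
  q₀ S m K W : ℕ
  q₀ = n / D
  S  = suc q₀
  m  = n + q₀
  K  = 2 * k
  W  = (5 + r′) * K * S

  D*q₀≤n : D * q₀ ≤ n
  D*q₀≤n = proj₁ (division n D)

  n<D*S : n < D * S
  n<D*S = proj₂ (division n D)

  D*S≤n+D : D * S ≤ n + D
  D*S≤n+D = begin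
    D * S        ≡⟨ *-suc D q₀ ⟩
    D + D * q₀   ≤⟨ +-monoʳ-≤ D D*q₀≤n ⟩
    D + n        ≡⟨ +-comm D n ⟩
    n + D        ∎
    where open ≤-Reasoning

  S-large : n ^ len ≤ (12 * r * S) ^ r
  S-large = *-cancelʳ-≤ (n ^ len) ((12 * r * S) ^ r) (k ^ r) {{m^n≢0 k r}} (begin
    n ^ len * k ^ r        ≤⟨ *-monoʳ-≤ (n ^ len) k^r≤n ⟩
    n ^ len * n            ≡⟨ *-comm (n ^ len) n ⟩
    n ^ r                  ≤⟨ ^-monoˡ-≤ r n≤12rSk ⟩
    (12 * r * S * k) ^ r   ≡⟨ *-distribʳ-^ (12 * r * S) k r ⟩
    (12 * r * S) ^ r * k ^ r ∎)
    where
    open ≤-Reasoning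
    n≤12rSk : n ≤ 12 * r * S * k
    n≤12rSk = ≤-trans (<⇒≤ n<D*S) (≤-reflexive (solve 3 (λ a k S → a :* k :* S := a :* S :* k) refl (12 * r) k S))

  b : ℕ
  b = 3 * (k / 3)

  b≤k : b ≤ k
  b≤k = ≤-trans (≤-reflexive (*-comm 3 (k / 3))) (m/n*n≤m k 3)

  k≤b+2 : k ≤ b + 2
  k≤b+2 = begin
    k                  ≡⟨ m≡m%n+[m/n]*n k 3 ⟩
    k % 3 + k / 3 * 3  ≤⟨ +-mono-≤ (s≤s⁻¹ (m%n<n k 3)) (≤-reflexive (*-comm (k / 3) 3)) ⟩
    2 + b              ≡⟨ +-comm 2 b ⟩
    b + 2              ∎
    where open ≤-Reasoning

  6≤b : 6 ≤ b
  6≤b = *-monoʳ-≤ 3 (/-monoˡ-≤ 3 6≤k)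

  b+3≤K : b + 3 ≤ K
  b+3≤K = ≤-trans (+-monoˡ-≤ 3 b≤k)
    (≤-trans (+-monoʳ-≤ k (≤-trans (s≤s (s≤s (s≤s z≤n))) 6≤k)) (≤-reflexive (sym (cong (k +_) (+-identityʳ k)))))

  b≤K : b ≤ K
  b≤K = ≤-trans (m≤m+n b 3) b+3≤K

  3∣b : 3 ∣ b
  3∣b = m∣m*n (k / 3)

  3∣b+3 : 3 ∣ b + 3
  3∣b+3 = ∣m∣n⇒∣m+n 3∣b (divides 1 refl)

  open Chain b

  fits : ℕ → Set
  fits i = volume (chain len i) * k ≤ m

  fits-zero : fits 0
  fits-zero = begin
    volume (chain len 0) * k  ≡⟨ cong (_* k) (volume-chain-zero len) ⟩
    b ^ len * k               ≤⟨ *-monoˡ-≤ k (^-monoˡ-≤ len b≤k) ⟩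
    k ^ len * k               ≡⟨ *-comm (k ^ len) k ⟩
    k ^ r                     ≤⟨ k^r≤n ⟩
    n                         ≤⟨ m≤m+n n q₀ ⟩
    m                         ∎
    where open ≤-Reasoning

  largest-fit : ∃ λ i → i ≤ len × fits i × (i ≡ len ⊎ i < len × ¬ fits (suc i))
  largest-fit = last-satisfying (λ i → volume (chain len i) * k ≤? m) fits-zero len

  i : ℕ
  i = proj₁ largest-fit

  q : ℕ
  q = volume (chain len i)

  q*k≤m : q * k ≤ m
  q*k≤m = proj₁ (proj₂ (proj₂ largest-fit))

  m<q*[1+K]-when-i≡len : i ≡ len → m < q * suc K
  m<q*[1+K]-when-i≡len i≡len = begin-strict
    n + q₀              <⟨ +-mono-<-≤ n<[1+k]q (<⇒≤ q₀<kq) ⟩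
    suc k * q + k * q   ≡⟨ solve 2 (λ k q → (con 1 :+ k) :* q :+ k :* q := q :* (con 1 :+ con 2 :* k)) refl k q ⟩
    q * suc K           ∎
    where
    open ≤-Reasoning
    [1+k]^len≤q : suc k ^ len ≤ q
    [1+k]^len≤q = begin
      suc k ^ len       ≤⟨ ^-monoˡ-≤ len (≤-trans (≤-reflexive (+-comm 1 k)) (+-monoˡ-≤ 1 k≤b+2)) ⟩
      (b + 2 + 1) ^ len ≡⟨ cong (_^ len) (+-assoc b 2 1) ⟩
      (b + 3) ^ len     ≡⟨ volume-chain-all len ⟨
      volume (chain len len) ≡⟨ cong (volume ∘ chain len) i≡len ⟨
      q                 ∎
    n<[1+k]q : n < suc k * q
    n<[1+k]q = <-≤-trans n<[1+k]^r (*-monoʳ-≤ (suc k) [1+k]^len≤q)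
    q₀<kq : q₀ < k * q
    q₀<kq = *-cancelˡ-< D q₀ (k * q) (begin-strict
      D * q₀        ≤⟨ D*q₀≤n ⟩
      n             <⟨ n<[1+k]q ⟩
      suc k * q     ≤⟨ *-monoˡ-≤ q (≤-trans 1+k≤2k (*-monoˡ-≤ k 2≤D)) ⟩
      D * k * q     ≡⟨ *-assoc D k q ⟩
      D * (k * q)   ∎)
      where
      1+k≤2k : suc k ≤ 2 * k
      1+k≤2k = ≤-trans (+-monoˡ-≤ k (≤-trans (s≤s z≤n) 6≤k)) (≤-reflexive (cong (k +_) (sym (+-identityʳ k))))
      2≤D : 2 ≤ D
      2≤D = ≤-trans (s≤s (s≤s z≤n)) (*-mono-≤ (*-monoʳ-≤ 12 {1} {r} (s≤s z≤n)) (≤-trans (s≤s z≤n) 6≤k))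

  m<q*[1+K]-when-i<len : i < len → ¬ fits (suc i) → m < q * suc K
  m<q*[1+K]-when-i<len i<len m≮ = ≤-trans (*-cancelˡ-< b m (q * K) (begin-strict
    b * m                             <⟨ *-monoʳ-< b {{b≢0}} (≰⇒> m≮) ⟩
    b * (volume (chain len (suc i)) * k) ≡⟨ *-assoc b _ k ⟨
    b * volume (chain len (suc i)) * k   ≡⟨ cong (_* k) (volume-chain-suc i<len) ⟩
    (b + 3) * q * k                   ≤⟨ *-monoˡ-≤ k (*-monoˡ-≤ q b+3≤2b) ⟩
    2 * b * q * k                     ≡⟨ solve 3 (λ b q k → con 2 :* b :* q :* k := b :* (q :* (con 2 :* k))) refl b q k ⟩
    b * (q * K)                       ∎)) (*-monoʳ-≤ q (n≤1+n K))
    where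
    open ≤-Reasoning
    b≢0 : NonZero b
    b≢0 = >-nonZero (≤-trans (s≤s z≤n) 6≤b)
    b+3≤2b : b + 3 ≤ 2 * b
    b+3≤2b = ≤-trans (+-monoʳ-≤ b (≤-trans (s≤s (s≤s (s≤s z≤n))) 6≤b)) (≤-reflexive (cong (b +_) (sym (+-identityʳ b))))

  m<q*[1+K] : m < q * suc K
  m<q*[1+K] with proj₂ (proj₂ (proj₂ largest-fit))
  ... | inj₁ i≡len           = m<q*[1+K]-when-i≡len i≡len
  ... | inj₂ (i<len , ¬fits) = m<q*[1+K]-when-i<len i<len ¬fits

  instance
    q≢0 : NonZero q
    q≢0 = m*n≢0⇒m≢0 q {{>-nonZero (≤-<-trans z≤n m<q*[1+K])}}

  L≤K : ∀ {L} → q * L ≤ m → L ≤ K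
  L≤K qL≤m = s≤s⁻¹ (*-cancelˡ-< q _ _ (≤-<-trans qL≤m m<q*[1+K]))

  -- The last side L leaves m − N < ρ q positions outside the torus; margin is the polynomial inequality
  -- that then yields m + 2W < 2N.
  module LastSide (L ρ : ℕ) (qL≤m : q * L ≤ m) (m<q[L+ρ] : m < q * (L + ρ)) (2ρ≤k : 2 * ρ ≤ k)
    (margin : n * ((5 + r′) * k) + n * (6 * r * ρ) + 12 * r * (5 + r′) * (k * k) ≤ n * (3 * r * k)) where

    open ≤-Reasoning
    N : ℕ
    N = q * L

    km<kN+ρm : k * m < k * N + ρ * m
    km<kN+ρm = begin-strict
      k * m                 <⟨ *-monoʳ-< k m<q[L+ρ] ⟩
      k * (q * (L + ρ))     ≡⟨ solve 4 (λ k q L ρ → k :* (q :* (L :+ ρ)) := k :* (q :* L) :+ ρ :* (q :* k)) refl k q L ρ ⟩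
      k * N + ρ * (q * k)   ≤⟨ +-monoʳ-≤ (k * N) (*-monoʳ-≤ ρ q*k≤m) ⟩
      k * N + ρ * m         ∎

    2kW+2ρm≤km : 2 * k * W + 2 * ρ * m ≤ k * m
    2kW+2ρm≤km = *-cancelˡ-≤ (3 * r) (begin
      3 * r * (2 * k * W + 2 * ρ * m)
        ≡⟨ solve 6 (λ r a k S ρ m → con 3 :* r :* (con 2 :* k :* (a :* (con 2 :* k) :* S) :+ con 2 :* ρ :* m)
                                  := a :* k :* (con 12 :* r :* k :* S) :+ con 6 :* r :* ρ :* m) refl r (5 + r′) k S ρ m ⟩
      (5 + r′) * k * (D * S) + 6 * r * ρ * m
        ≤⟨ +-monoˡ-≤ _ (*-monoʳ-≤ ((5 + r′) * k) D*S≤n+D) ⟩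
      (5 + r′) * k * (n + D) + 6 * r * ρ * (n + q₀)
        ≡⟨ solve 6 (λ r a k ρ n q → a :* k :* (n :+ con 12 :* r :* k) :+ con 6 :* r :* ρ :* (n :+ q)
                                  := n :* (a :* k) :+ n :* (con 6 :* r :* ρ) :+ con 12 :* r :* a :* (k :* k)
                                     :+ q :* (con 3 :* r :* (con 2 :* ρ)))
                 refl r (5 + r′) k ρ n q₀ ⟩
      n * ((5 + r′) * k) + n * (6 * r * ρ) + 12 * r * (5 + r′) * (k * k) + q₀ * (3 * r * (2 * ρ))
        ≤⟨ +-mono-≤ margin (*-monoʳ-≤ q₀ (*-monoʳ-≤ (3 * r) 2ρ≤k)) ⟩
      n * (3 * r * k) + q₀ * (3 * r * k)
        ≡⟨ solve 4 (λ r k n q → n :* (con 3 :* r :* k) :+ q :* (con 3 :* r :* k) := con 3 :* r :* (k :* (n :+ q))) refl r k n q₀ ⟩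
      3 * r * (k * m) ∎)

    m+2W<2N : m + 2 * W < 2 * N
    m+2W<2N = *-cancelˡ-< k (m + 2 * W) (2 * N) (+-cancelʳ-< (2 * ρ * m) _ _ (begin-strict
      k * (m + 2 * W) + 2 * ρ * m
        ≡⟨ solve 4 (λ k m W x → k :* (m :+ con 2 :* W) :+ x := k :* m :+ (con 2 :* k :* W :+ x)) refl k m W (2 * ρ * m) ⟩
      k * m + (2 * k * W + 2 * ρ * m) ≤⟨ +-monoʳ-≤ (k * m) 2kW+2ρm≤km ⟩
      k * m + k * m                 <⟨ +-mono-< km<kN+ρm km<kN+ρm ⟩
      (k * N + ρ * m) + (k * N + ρ * m)
        ≡⟨ solve 4 (λ k N ρ m → (k :* N :+ ρ :* m) :+ (k :* N :+ ρ :* m) := k :* (con 2 :* N) :+ con 2 :* ρ :* m) refl k N ρ m ⟩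
      k * (2 * N) + 2 * ρ * m       ∎))

    2W+f<N : 2 * W + (m ∸ N) < N
    2W+f<N = +-cancelʳ-< N _ _ (begin-strict
      2 * W + (m ∸ N) + N   ≡⟨ +-assoc (2 * W) (m ∸ N) N ⟩
      2 * W + (m ∸ N + N)   ≡⟨ cong (2 * W +_) (m∸n+n≡m qL≤m) ⟩
      2 * W + m             ≡⟨ +-comm (2 * W) m ⟩
      m + 2 * W             <⟨ m+2W<2N ⟩
      2 * N                 ≡⟨ cong (N +_) (+-identityʳ N) ⟩
      N + N                 ∎)

    W≤N : W ≤ N
    W≤N = ≤-trans (m≤m+n W (W + 0)) (≤-trans (m≤m+n (2 * W) (m ∸ N)) (<⇒≤ 2W+f<N))

    interior : (5 + r′) * K * S ≤ (N ∸ W) ∸ (m ∸ N)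
    interior = m+n≤o⇒m≤o∸n W (m+n≤o⇒m≤o∸n (W + (m ∸ N)) (begin
      W + (m ∸ N) + W       ≡⟨ solve 2 (λ W f → W :+ f :+ W := con 2 :* W :+ f) refl W (m ∸ N) ⟩
      2 * W + (m ∸ N)       ≤⟨ <⇒≤ 2W+f<N ⟩
      N                     ∎))

    twisted≤n : N ∸ W ≤ n
    twisted≤n = begin
      N ∸ W          ≤⟨ ∸-monoˡ-≤ W qL≤m ⟩
      n + q₀ ∸ W     ≤⟨ ∸-monoʳ-≤ (n + q₀) S≤W ⟩
      n + q₀ ∸ S     ≡⟨ cong (_∸ S) (+-comm n q₀) ⟩
      q₀ + n ∸ S     ≤⟨ ∸-monoˡ-≤ S (+-monoˡ-≤ n (n≤1+n q₀)) ⟩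
      S + n ∸ S      ≡⟨ m+n∸m≡n S n ⟩
      n              ∎
      where
      S≤W : S ≤ W
      S≤W = ≤-trans (≤-reflexive (sym (*-identityˡ S)))
        (*-monoˡ-≤ S (*-mono-≤ {1} {5 + r′} (s≤s z≤n) (≤-trans (s≤s z≤n) (≤-trans 6≤k (m≤m+n k (k + 0))))))

    size : N + (m ∸ N) + 1 ≡ n + S
    size = trans (cong (_+ 1) (m+[n∸m]≡n qL≤m)) (trans (+-assoc n q₀ 1) (cong (n +_) (+-comm q₀ 1)))

    design : (sides : Vec ℕ r) → (∀ u → 3 ∣ lookup sides (direction u)) → All (_≤ K) sides →
      volume sides ≡ q * L → TorusDesign r′ n
    design sides divisible sides≤K volume≡ = record
      { sides     = sides
      ; divisible = divisible
      ; K         = K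
      ; S         = S
      ; padding   = m ∸ N
      ; diagonal  = n ∸ (N ∸ W)
      ; twisted   = N ∸ W
      ; sides≤K   = sides≤K
      ; n≡        = m∸n+n≡m twisted≤n
      ; size      = subst (λ x → x + (m ∸ N) + 1 ≡ n + S) (sym volume≡) size
      ; interior  = interior
      ; exterior  = subst (λ x → W ≤ x ∸ (N ∸ W)) (sym volume≡) (≤-reflexive (sym (m∸[m∸n]≡n W≤N)))
      ; S-large   = S-large
      }

6*[4+x]*[6+x]≤6^[3+x] : ∀ x → 6 * (4 + x) * (6 + x) ≤ 6 ^ (3 + x)
6*[4+x]*[6+x]≤6^[3+x] zero    = m≤m+n 144 72
6*[4+x]*[6+x]≤6^[3+x] (suc x) = begin
  6 * (5 + x) * (7 + x)
    ≡⟨ solve 1 (λ x → con 6 :* (con 5 :+ x) :* (con 7 :+ x) := con 210 :+ con 72 :* x :+ con 6 :* (x :* x)) refl x ⟩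
  210 + 72 * x + 6 * (x * x)         ≤⟨ +-mono-≤ (+-mono-≤ (m≤m+n 210 654) (*-monoˡ-≤ x (m≤m+n 72 288))) (*-monoˡ-≤ (x * x) (m≤m+n 6 30)) ⟩
  864 + 360 * x + 36 * (x * x)
    ≡⟨ solve 1 (λ x → con 864 :+ con 360 :* x :+ con 36 :* (x :* x) := con 6 :* (con 6 :* (con 4 :+ x) :* (con 6 :+ x))) refl x ⟩
  6 * (6 * (4 + x) * (6 + x))        ≤⟨ *-monoʳ-≤ 6 (6*[4+x]*[6+x]≤6^[3+x] x) ⟩
  6 ^ (4 + x)                        ∎
  where open ≤-Reasoning

margin-four-or-more : ∀ x n k → 6 ≤ k → k ^ (4 + x) ≤ n →
  n * ((6 + x) * k) + n * (6 * (4 + x) * 1) + 12 * (4 + x) * (6 + x) * (k * k) ≤ n * (3 * (4 + x) * k)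
margin-four-or-more x n k 6≤k k^r≤n = begin
  n * ((6 + x) * k) + n * (6 * (4 + x) * 1) + 12 * (4 + x) * (6 + x) * (k * k)
    ≤⟨ +-mono-≤ (+-monoʳ-≤ (n * ((6 + x) * k)) (*-monoʳ-≤ n 6[4+x]≤[4+2x]k)) 12[4+x][6+x]k²≤2kn ⟩
  n * ((6 + x) * k) + n * ((4 + 2 * x) * k) + 2 * k * n
    ≡⟨ solve 3 (λ x n k → n :* ((con 6 :+ x) :* k) :+ n :* ((con 4 :+ con 2 :* x) :* k) :+ con 2 :* k :* n
                       := n :* (con 3 :* (con 4 :+ x) :* k)) refl x n k ⟩
  n * (3 * (4 + x) * k) ∎
  where
  open ≤-Reasoning
  6[4+x]≤[4+2x]k : 6 * (4 + x) * 1 ≤ (4 + 2 * x) * k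
  6[4+x]≤[4+2x]k = begin
    6 * (4 + x) * 1            ≤⟨ m≤m+n _ (6 * x) ⟩
    6 * (4 + x) * 1 + 6 * x    ≡⟨ solve 1 (λ x → con 6 :* (con 4 :+ x) :* con 1 :+ con 6 :* x := (con 4 :+ con 2 :* x) :* con 6) refl x ⟩
    (4 + 2 * x) * 6            ≤⟨ *-monoʳ-≤ (4 + 2 * x) 6≤k ⟩
    (4 + 2 * x) * k            ∎
  12[4+x][6+x]k²≤2kn : 12 * (4 + x) * (6 + x) * (k * k) ≤ 2 * k * n
  12[4+x][6+x]k²≤2kn = begin
    12 * (4 + x) * (6 + x) * (k * k)
      ≡⟨ solve 2 (λ x k → con 12 :* (con 4 :+ x) :* (con 6 :+ x) :* (k :* k)
                       := con 2 :* k :* (k :* (con 6 :* (con 4 :+ x) :* (con 6 :+ x)))) refl x k ⟩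
    2 * k * (k * (6 * (4 + x) * (6 + x)))
      ≤⟨ *-monoʳ-≤ (2 * k) (*-monoʳ-≤ k (≤-trans (6*[4+x]*[6+x]≤6^[3+x] x) (^-monoˡ-≤ (3 + x) 6≤k))) ⟩
    2 * k * (k ^ (4 + x))                     ≤⟨ *-monoʳ-≤ (2 * k) k^r≤n ⟩
    2 * k * n                                 ∎

margin-three : ∀ n k → 17 ≤ k → k ^ 3 ≤ n →
  n * (5 * k) + n * (6 * 3 * 3) + 12 * 3 * 5 * (k * k) ≤ n * (3 * 3 * k)
margin-three n k 17≤k k³≤n = begin
  n * (5 * k) + n * 54 + 180 * (k * k)   ≤⟨ +-monoʳ-≤ (n * (5 * k) + n * 54) 180k²≤14n ⟩
  n * (5 * k) + n * 54 + 14 * n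
    ≡⟨ solve 2 (λ n k → n :* (con 5 :* k) :+ n :* con 54 :+ con 14 :* n := n :* (con 5 :* k) :+ con 4 :* con 17 :* n) refl n k ⟩
  n * (5 * k) + 4 * 17 * n               ≤⟨ +-monoʳ-≤ (n * (5 * k)) (*-monoˡ-≤ n (*-monoʳ-≤ 4 17≤k)) ⟩
  n * (5 * k) + 4 * k * n                ≡⟨ solve 2 (λ n k → n :* (con 5 :* k) :+ con 4 :* k :* n := n :* (con 9 :* k)) refl n k ⟩
  n * (9 * k)                            ∎
  where
  open ≤-Reasoning
  180k²≤14n : 180 * (k * k) ≤ 14 * n
  180k²≤14n = begin
    180 * (k * k)       ≤⟨ *-monoˡ-≤ (k * k) (≤-trans (m≤m+n 180 58) (*-monoʳ-≤ 14 17≤k)) ⟩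
    14 * k * (k * k)    ≡⟨ solve 1 (λ k → con 14 :* k :* (k :* k) := con 14 :* (k :* (k :* (k :* con 1)))) refl k ⟩
    14 * k ^ 3          ≤⟨ *-monoʳ-≤ 14 k³≤n ⟩
    14 * n              ∎

design-four-or-more : ∀ x n k → k ^ (4 + x) ≤ n → n < suc k ^ (4 + x) → 6 ≤ k → TorusDesign (suc x) n
design-four-or-more x n k k^r≤n n<[1+k]^r 6≤k =
  LastSide.design L 1 qL≤m m<q[L+1] (≤-trans (s≤s (s≤s z≤n)) 6≤k) (margin-four-or-more x n k 6≤k k^r≤n)
    (chain len i ∷ʳ L) (divisible-∷ʳ (chain len i) L (chain-all 3∣b 3∣b+3 len i))
    (All-∷ʳ (chain-all b≤K b+3≤K len i) (L≤K qL≤m)) (volume-∷ʳ (chain len i) L)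
  where
  open Parameters (suc x) n k k^r≤n n<[1+k]^r 6≤k
  open Chain b
  L : ℕ
  L = m / q
  qL≤m : q * L ≤ m
  qL≤m = proj₁ (division m q)
  m<q[L+1] : m < q * (L + 1)
  m<q[L+1] = subst (λ y → m < q * y) (+-comm 1 L) (proj₂ (division m q))

design-three : ∀ n k → k ^ 3 ≤ n → n < suc k ^ 3 → 17 ≤ k → TorusDesign 0 n
design-three n k k³≤n n<[1+k]³ 17≤k =
  LastSide.design L 3 qL≤m m<q[L+3] (≤-trans (m≤m+n 6 11) 17≤k) (margin-three n k 17≤k k³≤n)
    (chain 2 i ∷ʳ L) (divisible-∷ʳ-last (chain 2 i) L (chain-all 3∣b 3∣b+3 2 i) (m∣m*n x))
    (All-∷ʳ (chain-all b≤K b+3≤K 2 i) (L≤K qL≤m)) (volume-∷ʳ (chain 2 i) L)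
  where
  open Parameters 0 n k k³≤n n<[1+k]³ (≤-trans (m≤m+n 6 11) 17≤k)
  open Chain b
  instance
    3q≢0 : NonZero (3 * q)
    3q≢0 = m*n≢0 3 q
  x L : ℕ
  x = m / (3 * q)
  L = 3 * x
  qL≤m : q * L ≤ m
  qL≤m = ≤-trans (≤-reflexive (solve 2 (λ q x → q :* (con 3 :* x) := con 3 :* q :* x) refl q x)) (proj₁ (division m (3 * q)))
  m<q[L+3] : m < q * (L + 3)
  m<q[L+3] = <-≤-trans (proj₂ (division m (3 * q)))
    (≤-reflexive (solve 2 (λ q x → con 3 :* q :* (con 1 :+ x) := q :* (con 3 :* x :+ con 3)) refl q x))

-- Parameters for r = 3 and 611 ≤ n < 4913

record Candidate : Set where
  constructor candidate
  field
    x₀ x₁ x₂ K S padding diagonal twisted : ℕ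

-- Division by zero returns 0, so that candidate-for is total.
_//_ : ℕ → ℕ → ℕ
m // zero  = 0
m // suc d = m / suc d

cube-root : ℕ → ℕ → ℕ
cube-root zero    n = 0
cube-root (suc k) n = if suc k ^ 3 ≤ᵇ n then suc k else cube-root k n

-- The sizes of design-three with K the largest side and threshold ⌊5k/4⌋ instead of k. Each intermediate
-- value is passed on as an argument so that evaluation shares it: all-valid evaluates this 4302 times.
candidate-for : ℕ → Candidate
candidate-for n = at-root (cube-root 17 n)
  where
  with-last : (S m x₀ x₁ L N K : ℕ) → Candidate
  with-last S m x₀ x₁ L N K = candidate x₀ x₁ L K S (m ∸ N) (n ∸ (N ∸ 5 * K * S)) (N ∸ 5 * K * S)

  with-sides : (S m x₀ x₁ L : ℕ) → Candidate
  with-sides S m x₀ x₁ L = with-last S m x₀ x₁ L (x₀ * x₁ * L) (x₀ ⊔ (x₁ ⊔ L))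

  with-pair : (S m x₀ x₁ : ℕ) → Candidate
  with-pair S m x₀ x₁ = with-sides S m x₀ x₁ (3 * (m // (3 * (x₀ * x₁))))

  with-base : (q₀ b λ₀ : ℕ) → Candidate
  with-base q₀ b λ₀ = with-pair (suc q₀) (n + q₀)
    (if (b + 3) * b * λ₀ ≤ᵇ n + q₀ then b + 3 else b)
    (if (b + 3) * (b + 3) * λ₀ ≤ᵇ n + q₀ then b + 3 else b)

  at-root : ℕ → Candidate
  at-root k = with-base (n // (36 * k)) (3 * (k / 3)) ((5 * k) / 4)

Valid : ℕ → Candidate → Set
Valid n (candidate x₀ x₁ x₂ K S padding diagonal twisted) =
  3 ∣ x₀ × 3 ∣ x₁ × 3 ∣ x₂ × 1 ≤ K × x₀ ≤ K × x₁ ≤ K × x₂ ≤ K ×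
  diagonal + twisted ≡ n × x₀ * (x₁ * (x₂ * 1)) + padding + 1 ≡ n + S ×
  5 * K * S ≤ twisted ∸ padding × 5 * K * S ≤ x₀ * (x₁ * (x₂ * 1)) ∸ twisted × n ^ 2 ≤ (36 * S) ^ 3

valid? : ∀ n c → Dec (Valid n c)
valid? n (candidate x₀ x₁ x₂ K S padding diagonal twisted) =
  3 ∣? x₀ ×-dec 3 ∣? x₁ ×-dec 3 ∣? x₂ ×-dec 1 ≤? K ×-dec x₀ ≤? K ×-dec x₁ ≤? K ×-dec x₂ ≤? K ×-dec
  diagonal + twisted ≟ n ×-dec x₀ * (x₁ * (x₂ * 1)) + padding + 1 ≟ n + S ×-dec
  5 * K * S ≤? twisted ∸ padding ×-dec 5 * K * S ≤? x₀ * (x₁ * (x₂ * 1)) ∸ twisted ×-dec n ^ 2 ≤? (36 * S) ^ 3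

valid⇒design : ∀ n c → Valid n c → TorusDesign 0 n
valid⇒design n (candidate x₀ x₁ x₂ K S padding diagonal twisted)
  (3∣x₀ , 3∣x₁ , 3∣x₂ , 1≤K , x₀≤K , x₁≤K , x₂≤K , n≡ , size , interior , exterior , S-large) = record
  { sides     = x₀ ∷ x₁ ∷ x₂ ∷ []
  ; divisible = λ { 0₃ → 3∣x₀ ; 1₃ → 3∣x₁ ; 2₃ → 3∣x₂ }
  ; K         = K
  ; S         = S
  ; padding   = padding
  ; diagonal  = diagonal
  ; twisted   = twisted
  ; K≢0       = >-nonZero 1≤K
  ; sides≤K   = x₀≤K ∷ x₁≤K ∷ x₂≤K ∷ []
  ; n≡        = n≡
  ; size      = size
  ; interior  = interior
  ; exterior  = exterior
  ; S-large   = S-large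
  }

all-valid : ∀ {j} → j < 4302 → Valid (611 + j) (candidate-for (611 + j))
all-valid = toWitness {a? = allUpTo? (λ j → valid? (611 + j) (candidate-for (611 + j))) 4302} tt

finite-design : ∀ n → 611 ≤ n → n < 4913 → TorusDesign 0 n
finite-design n 611≤n n<4913 = subst (TorusDesign 0) (m+[n∸m]≡n 611≤n)
  (valid⇒design (611 + j) (candidate-for (611 + j)) (all-valid j<4302))
  where
  j = n ∸ 611
  j<4302 : j < 4302
  j<4302 = +-cancelˡ-< 611 j 4302 (subst (_< 4913) (sym (m+[n∸m]≡n 611≤n)) n<4913)

-- 610 is the largest n with n² ≤ 72³, as small-case needs, and margin-three holds from 4913 = 17³ on.
counterexample-for : ∀ r′ n → 6 ^ (3 + r′) < n → Counterexample (3 + r′) n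
counterexample-for (suc x) n 6^r<n =
  let k , k^r≤n , n<[1+k]^r = integer-root (4 + x) n in
  design⇒counterexample (design-four-or-more x n k k^r≤n n<[1+k]^r (root-≥ (4 + x) 6 (<⇒≤ 6^r<n) n<[1+k]^r))
counterexample-for zero n 6³<n with n ≤? 610 | n <? 4913
... | yes n≤610 | _        =
  small-case n (≤-trans (s≤s (s≤s z≤n)) 6³<n) (≤-trans (*-mono-≤ n≤610 (*-mono-≤ n≤610 ≤-refl)) (m≤m+n 372100 1148))
... | no  n≰610 | yes n<4913 = design⇒counterexample (finite-design n (≰⇒> n≰610) n<4913)
... | no  _     | no  n≮4913 =
  let k , k³≤n , n<[1+k]³ = integer-root 3 n in
  design⇒counterexample (design-three n k k³≤n n<[1+k]³ (root-≥ 3 17 (≮⇒≥ n≮4913) n<[1+k]³))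

theorem2p5 : (r n : ℕ) → 3 ≤ r → 6 ^ r < n →
    Σ ℕ λ m →
      n ≤ m + 1 ×
      n ^ (r ∸ 1) ≤ (12 * r * (m + 1 ∸ n)) ^ r ×
      Σ (Fin n → List (Edge r)) λ Ms →
        (∀ i → IsMatching (Ms i) × length (Ms i) ≡ m) ×
        ¬ RainbowMatching n Ms n
theorem2p5 (suc (suc (suc r′))) n (s≤s (s≤s (s≤s z≤n))) = counterexample-for r′ n
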